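{- For $n\ge0$ and an indeterminate $\alpha$ let $D_n(\alpha)=\sum_{\pi}\alpha^{\mathrm{cyc}(\pi)}$, the sum over all derangements (fixed-point-free permutations) $\pi$ of $\{1,\dots,n\}$, where $\mathrm{cyc}(\pi)$ is the number of cycles of $\pi$. Let $(u)_m=u(u+1)\cdots(u+m-1)$. Then, as formal power series in $x,y,z$, \[ \sum_{l,m,n\ge0} D_{l+m}(\alpha)\, D_{l+n}(\beta)\,\frac{x^l}{l!}\frac{y^m}{m!}\frac{z^n}{n!} = e^{\alpha\beta x-\alpha y-\beta z}\sum_{l\ge0}\frac{(\alpha)_l(\beta)_l}{(1+\beta x-y)^{l+\alpha}(1+\alpha x-z)^{l+\beta}}\,\frac{x^l}{l!}. \]
   Context: $(1+w)^{ -e}$ for an indeterminate exponent $e$ and a power series $w$ without constant term denotes the formal binomial series $\sum_{m\ge0}(e)_m (-w)^m/m!$. -}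

module Defs where

open import Algebra.Bundles using (CommutativeRing)
open import Data.Nat as ℕ using (ℕ; zero; suc; _≤ᵇ_; _≡ᵇ_)
open import Data.Nat.Combinatorics using (_C_)
open import Data.Fin as Fin using (Fin; toℕ)
open import Data.Bool using (Bool; true; false; not; _∨_; _∧_; if_then_else_)
open import Data.List as List using (List; []; _∷_; map; concatMap; allFin; foldr; length; filterᵇ; upTo)
open import Data.Vec as Vec using (Vec; lookup)
open import Relation.Nullary.Decidable using (⌊_⌋)

all : ∀ {a} {A : Set a} → (A → Bool) → List A → Bool
all p = foldr (λ x b → p x ∧ b) true

-- all maps Fin n → Fin n, represented by their value tables (vectors of length k = n)
tables : (n k : ℕ) → List (Vec (Fin n) k)
tables n zero    = Vec.[] ∷ []
tables n (suc k) = concatMap (λ v → map (Vec._∷ v) (allFin n)) (tables n k)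

allMaps : (n : ℕ) → List (Vec (Fin n) n)
allMaps n = tables n n

iter : ∀ {n} → (Fin n → Fin n) → ℕ → Fin n → Fin n
iter f zero    i = i
iter f (suc k) i = f (iter f k i)

-- a map Fin n → Fin n is a permutation iff it is injective
isInjectiveᵇ : ∀ {n} → (Fin n → Fin n) → Bool
isInjectiveᵇ {n} f =
  all (λ i → all (λ j → not ⌊ f i Fin.≟ f j ⌋ ∨ ⌊ i Fin.≟ j ⌋) (allFin n)) (allFin n)

isFixedPointFreeᵇ : ∀ {n} → (Fin n → Fin n) → Bool
isFixedPointFreeᵇ {n} f = all (λ i → not ⌊ f i Fin.≟ i ⌋) (allFin n)

derangements : (n : ℕ) → List (Vec (Fin n) n)
derangements n =
  filterᵇ (λ v → isInjectiveᵇ (lookup v) ∧ isFixedPointFreeᵇ (lookup v)) (allMaps n)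

-- i is the smallest element of its cycle under f (the orbit of i is {f^k i | k < n})
isCycleMinᵇ : ∀ {n} → (Fin n → Fin n) → Fin n → Bool
isCycleMinᵇ {n} f i = all (λ k → toℕ i ≤ᵇ toℕ (iter f k i)) (upTo n)

-- number of cycles of a permutation = number of cycles' minimal elements
cyc : ∀ {n} → (Fin n → Fin n) → ℕ
cyc {n} f = length (filterᵇ (isCycleMinᵇ f) (allFin n))

-- Ring-valued part.  Formal power series in x,y,z are represented in
-- "exponential" (Hurwitz) form: s : ℕ → ℕ → ℕ → R stands for
--   Σ_{l,m,n} s l m n · x^l/l! · y^m/m! · z^n/n!.

module Series {c ℓ} (R : CommutativeRing c ℓ) where
  open CommutativeRing R

  sumL : List Carrier → Carrier
  sumL = foldr _+_ 0#

  sumTo : ℕ → (ℕ → Carrier) → Carrier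
  sumTo n f = sumL (map f (upTo (suc n)))

  infixr 8 _^_
  _^_ : Carrier → ℕ → Carrier
  a ^ zero  = 1#
  a ^ suc k = a * (a ^ k)

  fromℕ : ℕ → Carrier
  fromℕ zero    = 0#
  fromℕ (suc k) = 1# + fromℕ k

  rising : Carrier → ℕ → Carrier
  rising u zero    = 1#
  rising u (suc m) = rising u m * (u + fromℕ m)

  D : Carrier → ℕ → Carrier
  D α n = sumL (map (λ v → α ^ cyc (lookup v)) (derangements n))

  Series : Set c
  Series = ℕ → ℕ → ℕ → Carrier

  -- product of power series, in exponential-coefficient form
  infixl 7 _⊛_
  _⊛_ : Series → Series → Series
  (s ⊛ t) l m n =
    sumTo l λ i → sumTo m λ j → sumTo n λ k →
      fromℕ (l C i) * fromℕ (m C j) * fromℕ (n C k)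
        * s i j k * t (l ℕ.∸ i) (m ℕ.∸ j) (n ℕ.∸ k)

  scale : Carrier → Series → Series
  scale a s l m n = a * s l m n

  xPow/! : ℕ → Series
  xPow/! L l m n = if (l ≡ᵇ L) ∧ (m ≡ᵇ 0) ∧ (n ≡ᵇ 0) then 1# else 0#

  -- e^{a x + b y + c z} = Σ (ax)^l/l! (by)^m/m! (cz)^n/n!
  expLin : Carrier → Carrier → Carrier → Series
  expLin a b c l m n = a ^ l * b ^ m * c ^ n

  -- (1 + w)^{-e} = Σ_K (e)_K (-w)^K / K!  for w = a x + b y + c z,
  -- using (-w)^K/K! = Σ_{i+j+k=K} (-a x)^i/i! (-b y)^j/j! (-c z)^k/k!
  binomLin : Carrier → Carrier → Carrier → Carrier → Series
  binomLin e a b c i j k =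
    rising e (i ℕ.+ j ℕ.+ k) * (- a) ^ i * (- b) ^ j * (- c) ^ k

  -- formal sum Σ_l t l of series where t l is divisible by x^l
  -- (only the terms l ≤ L contribute to the coefficient of x^L)
  sumX : (ℕ → Series) → Series
  sumX t L M N = sumTo L (λ l → t l L M N)

  LHS : Carrier → Carrier → Series
  LHS α β l m n = D α (l ℕ.+ m) * D β (l ℕ.+ n)

  RHS : Carrier → Carrier → Series
  RHS α β =
    expLin (α * β) (- α) (- β) ⊛
    sumX (λ l → scale (rising α l * rising β l)
                  (xPow/! l
                   ⊛ binomLin (fromℕ l + α) β (- 1#) 0#
                   ⊛ binomLin (fromℕ l + β) α 0# (- 1#)))

module Submission where

-- Write LHS(l,m,n) and RHS(l,m,n) for the exponential coefficients of the
-- two sides.  Both satisfy the shift relation X(l+1,m,n) = X(l,m+1,n+1):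
-- for LHS this is just D_{(l+1)+m} = D_{l+(m+1)}; for RHS it follows from
-- the Leibniz rules of the coordinate derivatives ∂x, ∂y, ∂z for the
-- exponential (Hurwitz) product, applied to the exponential and binomial
-- factors, together with a telescoping sum over the index l of the inner
-- series.  Hence it suffices to compare the planes l = 0.  There RHS(0,m,n)
-- factors as d_α(m) d_β(n), where d_a(M) = Σ_j C(M,j) (-a)^j (a)_{M-j}
-- satisfies d_a(0) = 1, d_a(1) = 0, d_a(M+2) = (M+1) (d_a(M+1) + a d_a(M)).
-- On the combinatorial side, Fix n k, the count of permutations of [n] with
-- exactly k fixed points weighted by a^(number of non-trivial cycles), obeys
-- a recursion obtained by removing the point 0 from a permutation, and
-- Fix n k = C(n,k) d_a(n-k) follows by induction on n; k = 0 gives D = d.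

open import Defs
open import Algebra.Bundles using (CommutativeRing)
open import Data.Nat using (ℕ)

-- Arithmetic in an arbitrary commutative ring: the natural-number embedding
-- fromℕ is a semiring homomorphism, and the integers map into the ring, which
-- lets us use the stdlib ring solver with integer coefficients.
module RingArithmetic {c ℓ} (R : CommutativeRing c ℓ) where

  open import Algebra.Solver.Ring.AlmostCommutativeRing
    using (AlmostCommutativeRing; fromCommutativeRing; _-Raw-AlmostCommutative⟶_)
  open import Data.Integer as ℤ using (ℤ; +_; -[1+_])
  import Data.Integer.Properties as ℤP
  open import Data.Maybe using (Maybe; just; nothing)
  open import Data.Nat as ℕ using (zero; suc)
  open import Data.Sign as Sign using (Sign)
  open import Relation.Binary.PropositionalEquality as ≡ using (_≡_)
  open import Relation.Nullary using (yes; no)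

  open CommutativeRing R public
  open Series R public
  open import Algebra.Properties.Ring ring public
    using (-‿distribˡ-*; -‿distribʳ-*; -‿involutive; -0#≈0#; -‿+-comm)
  open import Relation.Binary.Reasoning.Setoid setoid public

  ≡⇒≈ : ∀ {x y} → x ≡ y → x ≈ y
  ≡⇒≈ ≡.refl = refl

  fromℕ-+ : ∀ m n → fromℕ (m ℕ.+ n) ≈ fromℕ m + fromℕ n
  fromℕ-+ zero    n = sym (+-identityˡ _)
  fromℕ-+ (suc m) n = trans (+-congˡ (fromℕ-+ m n)) (sym (+-assoc _ _ _))

  fromℕ-* : ∀ m n → fromℕ (m ℕ.* n) ≈ fromℕ m * fromℕ n
  fromℕ-* zero    n = sym (zeroˡ _)
  fromℕ-* (suc m) n = begin
    fromℕ (n ℕ.+ m ℕ.* n)            ≈⟨ fromℕ-+ n (m ℕ.* n) ⟩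
    fromℕ n + fromℕ (m ℕ.* n)        ≈⟨ +-congˡ (fromℕ-* m n) ⟩
    fromℕ n + fromℕ m * fromℕ n      ≈⟨ +-congʳ (sym (*-identityˡ _)) ⟩
    1# * fromℕ n + fromℕ m * fromℕ n ≈⟨ sym (distribʳ _ _ _) ⟩
    (1# + fromℕ m) * fromℕ n         ∎

  -- A variant of fromℕ with nat 1 = 1# definitionally, so that the solver
  -- constants 0 and 1 denote 0# and 1# on the nose.
  nat : ℕ → Carrier
  nat zero          = 0#
  nat (suc zero)    = 1#
  nat (suc (suc n)) = 1# + nat (suc n)

  nat≈fromℕ : ∀ n → nat n ≈ fromℕ n
  nat≈fromℕ zero          = refl
  nat≈fromℕ (suc zero)    = sym (+-identityʳ 1#)
  nat≈fromℕ (suc (suc n)) = +-congˡ (nat≈fromℕ (suc n))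

  ⟦_⟧ℤ : ℤ → Carrier
  ⟦ + n ⟧ℤ     = nat n
  ⟦ -[1+ n ] ⟧ℤ = - nat (suc n)

  signed : Sign → ℕ → Carrier
  signed Sign.+ n = fromℕ n
  signed Sign.- n = - fromℕ n

  ⟦◃⟧ : ∀ s n → ⟦ s ℤ.◃ n ⟧ℤ ≈ signed s n
  ⟦◃⟧ Sign.+ zero    = refl
  ⟦◃⟧ Sign.- zero    = sym -0#≈0#
  ⟦◃⟧ Sign.+ (suc n) = nat≈fromℕ (suc n)
  ⟦◃⟧ Sign.- (suc n) = -‿cong (nat≈fromℕ (suc n))

  ⟦⟧-sign-abs : ∀ i → ⟦ i ⟧ℤ ≈ signed (ℤ.sign i) ℤ.∣ i ∣
  ⟦⟧-sign-abs (+ zero)  = refl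
  ⟦⟧-sign-abs (+ suc n) = nat≈fromℕ (suc n)
  ⟦⟧-sign-abs -[1+ n ]  = -‿cong (nat≈fromℕ (suc n))

  signed-* : ∀ s t m n → signed (s Sign.* t) (m ℕ.* n) ≈ signed s m * signed t n
  signed-* Sign.+ Sign.+ m n = fromℕ-* m n
  signed-* Sign.+ Sign.- m n = trans (-‿cong (fromℕ-* m n)) (-‿distribʳ-* _ _)
  signed-* Sign.- Sign.+ m n = trans (-‿cong (fromℕ-* m n)) (-‿distribˡ-* _ _)
  signed-* Sign.- Sign.- m n =
    trans (fromℕ-* m n)
      (trans (sym (-‿involutive _)) (trans (-‿cong (-‿distribˡ-* _ _)) (-‿distribʳ-* _ _)))

  ⟦⊖⟧ : ∀ m n → ⟦ m ℤ.⊖ n ⟧ℤ ≈ fromℕ m - fromℕ n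
  ⟦⊖⟧ m zero = begin
    ⟦ m ℤ.⊖ 0 ⟧ℤ     ≡⟨ ≡.cong ⟦_⟧ℤ (ℤP.⊖-≥ {m} {0} ℕ.z≤n) ⟩
    nat m            ≈⟨ nat≈fromℕ m ⟩
    fromℕ m          ≈⟨ sym (+-identityʳ _) ⟩
    fromℕ m + 0#     ≈⟨ +-congˡ (sym -0#≈0#) ⟩
    fromℕ m - 0#     ∎
  ⟦⊖⟧ zero (suc n) = begin
    ⟦ 0 ℤ.⊖ suc n ⟧ℤ ≡⟨ ≡.cong ⟦_⟧ℤ (ℤP.⊖-< {0} {suc n} (ℕ.s≤s ℕ.z≤n)) ⟩
    - nat (suc n)    ≈⟨ -‿cong (nat≈fromℕ (suc n)) ⟩
    - fromℕ (suc n)  ≈⟨ sym (+-identityˡ _) ⟩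
    0# - fromℕ (suc n) ∎
  ⟦⊖⟧ (suc m) (suc n) = begin
    ⟦ suc m ℤ.⊖ suc n ⟧ℤ              ≡⟨ ≡.cong ⟦_⟧ℤ (ℤP.[1+m]⊖[1+n]≡m⊖n m n) ⟩
    ⟦ m ℤ.⊖ n ⟧ℤ                      ≈⟨ ⟦⊖⟧ m n ⟩
    fromℕ m - fromℕ n                 ≈⟨ sym (+-identityˡ _) ⟩
    0# + (fromℕ m - fromℕ n)          ≈⟨ +-congʳ (sym (-‿inverseʳ 1#)) ⟩
    (1# - 1#) + (fromℕ m - fromℕ n)   ≈⟨ +-interchange ⟩
    (1# + fromℕ m) + (- 1# - fromℕ n) ≈⟨ +-congˡ (-‿+-comm _ _) ⟩
    (1# + fromℕ m) - (1# + fromℕ n)   ∎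
    where
    +-interchange : ∀ {a b x y} → (a + b) + (x + y) ≈ (a + x) + (b + y)
    +-interchange = trans (+-assoc _ _ _)
      (trans (+-congˡ (trans (sym (+-assoc _ _ _)) (trans (+-congʳ (+-comm _ _)) (+-assoc _ _ _))))
        (sym (+-assoc _ _ _)))

  ⟦+⟧ : ∀ i j → ⟦ i ℤ.+ j ⟧ℤ ≈ ⟦ i ⟧ℤ + ⟦ j ⟧ℤ
  ⟦+⟧ (+ m) (+ n) =
    trans (nat≈fromℕ (m ℕ.+ n))
      (trans (fromℕ-+ m n) (+-cong (sym (nat≈fromℕ m)) (sym (nat≈fromℕ n))))
  ⟦+⟧ (+ m) -[1+ n ] =
    trans (⟦⊖⟧ m (suc n)) (+-cong (sym (nat≈fromℕ m)) (-‿cong (sym (nat≈fromℕ (suc n)))))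
  ⟦+⟧ -[1+ m ] (+ n) =
    trans (⟦⊖⟧ n (suc m))
      (trans (+-comm _ _) (+-cong (-‿cong (sym (nat≈fromℕ (suc m)))) (sym (nat≈fromℕ n))))
  ⟦+⟧ -[1+ m ] -[1+ n ] = begin
    - nat (suc (suc (m ℕ.+ n)))
      ≈⟨ -‿cong (nat≈fromℕ (suc (suc (m ℕ.+ n)))) ⟩
    - (1# + fromℕ (suc m ℕ.+ n))
      ≈⟨ -‿cong (+-congˡ (fromℕ-+ (suc m) n)) ⟩
    - (1# + (fromℕ (suc m) + fromℕ n))
      ≈⟨ -‿cong (trans (sym (+-assoc _ _ _)) (trans (+-congʳ (+-comm _ _)) (+-assoc _ _ _))) ⟩
    - (fromℕ (suc m) + fromℕ (suc n))
      ≈⟨ sym (-‿+-comm _ _) ⟩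
    - fromℕ (suc m) - fromℕ (suc n)
      ≈⟨ +-cong (-‿cong (sym (nat≈fromℕ (suc m)))) (-‿cong (sym (nat≈fromℕ (suc n)))) ⟩
    - nat (suc m) - nat (suc n) ∎

  ⟦*⟧ : ∀ i j → ⟦ i ℤ.* j ⟧ℤ ≈ ⟦ i ⟧ℤ * ⟦ j ⟧ℤ
  ⟦*⟧ i j =
    trans (⟦◃⟧ (ℤ.sign i Sign.* ℤ.sign j) (ℤ.∣ i ∣ ℕ.* ℤ.∣ j ∣))
      (trans (signed-* (ℤ.sign i) (ℤ.sign j) ℤ.∣ i ∣ ℤ.∣ j ∣)
        (*-cong (sym (⟦⟧-sign-abs i)) (sym (⟦⟧-sign-abs j))))

  ⟦-⟧ : ∀ i → ⟦ ℤ.- i ⟧ℤ ≈ - ⟦ i ⟧ℤ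
  ⟦-⟧ (+ zero)  = sym -0#≈0#
  ⟦-⟧ (+ suc n) = refl
  ⟦-⟧ -[1+ n ]  = sym (-‿involutive _)

  ℤ⟶R : AlmostCommutativeRing.rawRing (fromCommutativeRing ℤP.+-*-commutativeRing)
          -Raw-AlmostCommutative⟶ fromCommutativeRing R
  ℤ⟶R = record
    { ⟦_⟧ = ⟦_⟧ℤ ; +-homo = ⟦+⟧ ; *-homo = ⟦*⟧ ; -‿homo = ⟦-⟧
    ; 0-homo = refl ; 1-homo = refl }

  ℤ-equal? : ∀ a b → Maybe (⟦ a ⟧ℤ ≈ ⟦ b ⟧ℤ)
  ℤ-equal? a b with a ℤ.≟ b
  ... | yes ≡.refl = just refl
  ... | no _       = nothing

  open import Algebra.Solver.Ring
      (AlmostCommutativeRing.rawRing (fromCommutativeRing ℤP.+-*-commutativeRing))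
      (fromCommutativeRing R) ℤ⟶R ℤ-equal? public
    using (solve; _:=_; _:+_; _:*_; :-_; con)

-- The sum is abstract so that
-- large goals are not unfolded during type checking.
module FiniteSums {c ℓ} (R : CommutativeRing c ℓ) where

  open import Data.List using (map; applyUpTo)
  open import Data.Nat as ℕ using (zero; suc)
  open import Relation.Binary.PropositionalEquality as ≡ using (_≡_)
  open RingArithmetic R

  abstract
    ∑ : ℕ → (ℕ → Carrier) → Carrier
    ∑ zero    f = 0#
    ∑ (suc n) f = f 0 + ∑ n (λ i → f (suc i))

    ∑-zero : ∀ f → ∑ 0 f ≈ 0#
    ∑-zero f = refl

    ∑-suc : ∀ n f → ∑ (suc n) f ≈ f 0 + ∑ n (λ i → f (suc i))
    ∑-suc n f = refl

    sumTo≈∑ : ∀ n f → sumTo n f ≈ ∑ (suc n) f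
    sumTo≈∑ n f = ≡⇒≈ (sum-applyUpTo (λ i → i) (suc n))
      where
      sum-applyUpTo : ∀ h k → sumL (map f (applyUpTo h k)) ≡ ∑ k (λ i → f (h i))
      sum-applyUpTo h zero    = ≡.refl
      sum-applyUpTo h (suc k) = ≡.cong (f (h 0) +_) (sum-applyUpTo (λ i → h (suc i)) k)

    ∑-cong : ∀ n {f g} → (∀ i → i ℕ.< n → f i ≈ g i) → ∑ n f ≈ ∑ n g
    ∑-cong zero    h = refl
    ∑-cong (suc n) h = +-cong (h 0 (ℕ.s≤s ℕ.z≤n)) (∑-cong n (λ i p → h (suc i) (ℕ.s≤s p)))

    ∑-cong′ : ∀ n {f g} → (∀ i → f i ≈ g i) → ∑ n f ≈ ∑ n g
    ∑-cong′ n h = ∑-cong n (λ i _ → h i)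

    ∑-+ : ∀ n f g → ∑ n (λ i → f i + g i) ≈ ∑ n f + ∑ n g
    ∑-+ zero    f g = sym (+-identityʳ 0#)
    ∑-+ (suc n) f g = trans (+-congˡ (∑-+ n _ _))
      (solve 4 (λ a b x y → (a :+ b) :+ (x :+ y) := (a :+ x) :+ (b :+ y)) refl _ _ _ _)

    ∑-*ˡ : ∀ n x f → x * ∑ n f ≈ ∑ n (λ i → x * f i)
    ∑-*ˡ zero    x f = zeroʳ x
    ∑-*ˡ (suc n) x f = trans (distribˡ _ _ _) (+-congˡ (∑-*ˡ n x _))

    ∑-neg : ∀ n f → ∑ n (λ i → - f i) ≈ - ∑ n f
    ∑-neg zero    f = sym -0#≈0#
    ∑-neg (suc n) f = trans (+-congˡ (∑-neg n _)) (-‿+-comm _ _)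

    ∑-- : ∀ n f g → ∑ n (λ i → f i - g i) ≈ ∑ n f - ∑ n g
    ∑-- n f g = trans (∑-+ n f (λ i → - g i)) (+-congˡ (∑-neg n g))

    ∑-0 : ∀ n {f} → (∀ i → i ℕ.< n → f i ≈ 0#) → ∑ n f ≈ 0#
    ∑-0 zero    h = refl
    ∑-0 (suc n) h =
      trans (+-cong (h 0 (ℕ.s≤s ℕ.z≤n)) (∑-0 n (λ i p → h (suc i) (ℕ.s≤s p)))) (+-identityʳ 0#)

    ∑-last : ∀ n f → ∑ (suc n) f ≈ ∑ n f + f n
    ∑-last zero    f = trans (+-identityʳ _) (sym (+-identityˡ _))
    ∑-last (suc n) f = trans (+-congˡ (∑-last n _)) (sym (+-assoc _ _ _))

    ∑-swap : ∀ a b (f : ℕ → ℕ → Carrier) →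
             ∑ a (λ i → ∑ b (λ j → f i j)) ≈ ∑ b (λ j → ∑ a (λ i → f i j))
    ∑-swap zero    b f = sym (∑-0 b (λ _ _ → refl))
    ∑-swap (suc a) b f = trans (+-congˡ (∑-swap a b _)) (sym (∑-+ b _ _))

  previous : (ℕ → Carrier) → ℕ → Carrier
  previous w zero    = 0#
  previous w (suc l) = w l

  telescope : ∀ n w → ∑ (suc n) (λ l → w l - previous w l) ≈ w n
  telescope zero w =
    trans (∑-suc 0 _) (trans (+-cong (trans (+-congˡ -0#≈0#) (+-identityʳ _)) (∑-zero _)) (+-identityʳ _))
  telescope (suc n) w = begin
    ∑ (suc (suc n)) (λ l → w l - previous w l)  ≈⟨ ∑-last (suc n) _ ⟩
    ∑ (suc n) (λ l → w l - previous w l) + (w (suc n) - w n) ≈⟨ +-congʳ (telescope n w) ⟩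
    w n + (w (suc n) - w n)                     ≈⟨ solve 2 (λ a b → a :+ (b :+ :- a) := b) refl (w n) (w (suc n)) ⟩
    w (suc n)                                   ∎

module Binomial where

  open import Data.Nat
  open import Data.Nat.Properties
  open import Data.Nat.Combinatorics
  open import Data.Nat.Tactic.RingSolver using (solve-∀)
  open import Relation.Binary.PropositionalEquality
  open ≡-Reasoning

  pascal : ∀ n k → suc n C suc k ≡ n C k + n C suc k
  pascal n k = sym (nCk+nC[k+1]≡[n+1]C[k+1] n k)

  absorption : ∀ n k → suc k * (suc n C suc k) ≡ suc n * (n C k)
  absorption n zero = begin
    1 * (suc n C 1) ≡⟨ *-identityˡ _ ⟩
    suc n C 1       ≡⟨ nC1≡n (suc n) ⟩
    suc n           ≡⟨ sym (*-identityʳ (suc n)) ⟩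
    suc n * 1       ∎
  absorption zero (suc k) = begin
    suc (suc k) * 0 ≡⟨ *-zeroʳ (suc (suc k)) ⟩
    0               ∎
  absorption (suc n) (suc k) = begin
    suc (suc k) * (suc (suc n) C suc (suc k)) ≡⟨ cong (suc (suc k) *_) (pascal (suc n) (suc k)) ⟩
    suc (suc k) * (a + b)            ≡⟨ split (suc k) a b ⟩
    suc k * a + a + suc (suc k) * b  ≡⟨ cong₂ (λ u v → u + a + v) (absorption n k) (absorption n (suc k)) ⟩
    suc n * x + a + suc n * y        ≡⟨ collect (suc n) x y a ⟩
    suc n * (x + y) + a              ≡⟨ cong (λ u → suc n * u + a) (sym (pascal n k)) ⟩
    suc n * a + a                    ≡⟨ +-comm (suc n * a) a ⟩
    suc (suc n) * a                  ∎
    where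
    a = suc n C suc k
    b = suc n C suc (suc k)
    x = n C k
    y = n C suc k
    split : ∀ k a b → suc k * (a + b) ≡ k * a + a + suc k * b
    split = solve-∀
    collect : ∀ m x y a → m * x + a + m * y ≡ m * (x + y) + a
    collect = solve-∀

  -- (k+1) C(n,k+1) = (n-k) C(n,k), written with n = k + j
  C-trade : ∀ k j → suc k * ((k + j) C suc k) ≡ j * ((k + j) C k)
  C-trade k j = +-cancelˡ-≡ (suc k * x) _ _ (begin
    suc k * x + suc k * ((k + j) C suc k) ≡⟨ sym (*-distribˡ-+ (suc k) x _) ⟩
    suc k * (x + (k + j) C suc k)         ≡⟨ cong (suc k *_) (sym (pascal (k + j) k)) ⟩
    suc k * (suc (k + j) C suc k)         ≡⟨ absorption (k + j) k ⟩
    (suc k + j) * x                       ≡⟨ *-distribʳ-+ x (suc k) j ⟩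
    suc k * x + j * x                     ∎)
    where
    x = (k + j) C k

  -- C(N+1,j) (N+1-j) = (N+1) C(N,j), written with N = j + t
  C-complement : ∀ j t → (suc (j + t) C j) * suc t ≡ suc (j + t) * ((j + t) C j)
  C-complement j t = begin
    (suc (j + t) C j) * suc t           ≡⟨ *-comm _ (suc t) ⟩
    suc t * (suc (j + t) C j)           ≡⟨ cong (λ n → suc t * (n C j)) (sym (+-suc j t)) ⟩
    suc t * ((j + suc t) C j)           ≡⟨ sym (C-trade j (suc t)) ⟩
    suc j * ((j + suc t) C suc j)       ≡⟨ cong (λ n → suc j * (n C suc j)) (+-suc j t) ⟩
    suc j * (suc (j + t) C suc j)       ≡⟨ absorption (j + t) j ⟩
    suc (j + t) * ((j + t) C j)         ∎

-- The one-variable exponential convolution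
--   conv l G = Σ_{i≤l} C(l,i) G(i, l-i),
-- which computes the coefficient of x^l/l! in a product of exponential
-- series.
module Convolution {c ℓ} (R : CommutativeRing c ℓ) where

  open import Data.Nat as ℕ using (suc; _∸_)
  open import Data.Nat.Combinatorics using (_C_; nCn≡1; k>n⇒nCk≡0)
  import Data.Nat.Properties as ℕP
  open import Relation.Binary.PropositionalEquality as ≡ using (_≡_)
  open RingArithmetic R
  open FiniteSums R
  open Binomial

  binom : ℕ → ℕ → Carrier
  binom n k = fromℕ (n C k)

  binom-zero : ∀ n → binom n 0 ≈ 1#
  binom-zero n = +-identityʳ 1#

  binom-diag : ∀ n → binom n n ≈ 1#
  binom-diag n = trans (≡⇒≈ (≡.cong fromℕ (nCn≡1 n))) (+-identityʳ 1#)

  binom-big : ∀ n k → n ℕ.< k → binom n k ≈ 0#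
  binom-big n k lt = ≡⇒≈ (≡.cong fromℕ (k>n⇒nCk≡0 lt))

  binom-pascal : ∀ n k → binom (suc n) (suc k) ≈ binom n k + binom n (suc k)
  binom-pascal n k = trans (≡⇒≈ (≡.cong fromℕ (pascal n k))) (fromℕ-+ (n C k) (n C suc k))

  binom-trade : ∀ k j → fromℕ (suc k) * binom (k ℕ.+ j) (suc k) ≈ fromℕ j * binom (k ℕ.+ j) k
  binom-trade k j =
    trans (sym (fromℕ-* (suc k) ((k ℕ.+ j) C suc k)))
      (trans (≡⇒≈ (≡.cong fromℕ (C-trade k j))) (fromℕ-* j ((k ℕ.+ j) C k)))

  abstract
    conv : ℕ → (ℕ → ℕ → Carrier) → Carrier
    conv l G = ∑ (suc l) (λ i → binom l i * G i (l ∸ i))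

    conv-def : ∀ l G → conv l G ≈ ∑ (suc l) (λ i → binom l i * G i (l ∸ i))
    conv-def l G = refl

    conv-cong : ∀ l {G G'} → (∀ i i' → G i i' ≈ G' i i') → conv l G ≈ conv l G'
    conv-cong l h = ∑-cong′ (suc l) (λ i → *-congˡ (h _ _))

    conv-+ : ∀ l G G' → conv l (λ i i' → G i i' + G' i i') ≈ conv l G + conv l G'
    conv-+ l G G' = trans (∑-cong′ (suc l) (λ i → distribˡ _ _ _)) (∑-+ (suc l) _ _)

    conv-* : ∀ l x G → conv l (λ i i' → x * G i i') ≈ x * conv l G
    conv-* l x G =
      trans (∑-cong′ (suc l) (λ i → solve 3 (λ p q y → p :* (q :* y) := q :* (p :* y)) refl _ _ _))
        (sym (∑-*ˡ (suc l) x _))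

    conv-swap : ∀ a b (K : ℕ → ℕ → ℕ → ℕ → Carrier) →
      conv a (λ i i' → conv b (λ j j' → K i i' j j')) ≈ conv b (λ j j' → conv a (λ i i' → K i i' j j'))
    conv-swap a b K = begin
      ∑ (suc a) (λ i → binom a i * ∑ (suc b) (λ j → binom b j * K i (a ∸ i) j (b ∸ j)))
        ≈⟨ ∑-cong′ (suc a) (λ i → ∑-*ˡ (suc b) _ _) ⟩
      ∑ (suc a) (λ i → ∑ (suc b) (λ j → binom a i * (binom b j * K i (a ∸ i) j (b ∸ j))))
        ≈⟨ ∑-swap (suc a) (suc b) _ ⟩
      ∑ (suc b) (λ j → ∑ (suc a) (λ i → binom a i * (binom b j * K i (a ∸ i) j (b ∸ j))))
        ≈⟨ ∑-cong′ (suc b) (λ j → ∑-cong′ (suc a) (λ i →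
             solve 3 (λ p q x → p :* (q :* x) := q :* (p :* x)) refl _ _ _)) ⟩
      ∑ (suc b) (λ j → ∑ (suc a) (λ i → binom b j * (binom a i * K i (a ∸ i) j (b ∸ j))))
        ≈⟨ sym (∑-cong′ (suc b) (λ j → ∑-*ˡ (suc a) _ _)) ⟩
      ∑ (suc b) (λ j → binom b j * ∑ (suc a) (λ i → binom a i * K i (a ∸ i) j (b ∸ j))) ∎

    conv-0 : ∀ l {G} → (∀ i i' → i ℕ.≤ l → G i i' ≈ 0#) → conv l G ≈ 0#
    conv-0 l {G} h = ∑-0 (suc l) (λ i lt → trans (*-congˡ (h i (l ∸ i) (ℕP.≤-pred lt))) (zeroʳ _))

    conv-length0 : ∀ G → conv 0 G ≈ G 0 0
    conv-length0 G =
      trans (∑-suc 0 _) (trans (+-cong (trans (*-congʳ (binom-zero 0)) (*-identityˡ _)) (∑-zero _)) (+-identityʳ _))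

    conv-first : ∀ l {G} → (∀ i i' → G (suc i) i' ≈ 0#) → conv l G ≈ G 0 l
    conv-first l {G} h = begin
      ∑ (suc l) (λ i → binom l i * G i (l ∸ i))
        ≈⟨ ∑-suc l _ ⟩
      binom l 0 * G 0 l + ∑ l (λ i → binom l (suc i) * G (suc i) (l ∸ suc i))
        ≈⟨ +-cong (trans (*-congʳ (binom-zero l)) (*-identityˡ _))
                  (∑-0 l (λ i _ → trans (*-congˡ (h i _)) (zeroʳ _))) ⟩
      G 0 l + 0#
        ≈⟨ +-identityʳ _ ⟩
      G 0 l ∎

    conv-last : ∀ l {G} → (∀ i i' → G i (suc i') ≈ 0#) → conv l G ≈ G l 0
    conv-last l {G} h = begin
      ∑ (suc l) (λ i → binom l i * G i (l ∸ i))
        ≈⟨ ∑-last l (λ i → binom l i * G i (l ∸ i)) ⟩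
      ∑ l (λ i → binom l i * G i (l ∸ i)) + binom l l * G l (l ∸ l)
        ≈⟨ +-cong (∑-0 l (λ i lt → trans (*-congˡ (trans (≡⇒≈ (≡.cong (G i) (ℕP.+-∸-assoc 1 lt))) (h i _))) (zeroʳ _)))
                  (trans (*-congʳ (binom-diag l)) (trans (*-identityˡ _) (≡⇒≈ (≡.cong (G l) (ℕP.n∸n≡0 l))))) ⟩
      0# + G l 0
        ≈⟨ +-identityˡ _ ⟩
      G l 0 ∎

    conv-absorb : ∀ m (H : ℕ → ℕ → Carrier) →
      conv (suc m) (λ j j' → fromℕ j' * H j j') ≈ fromℕ (suc m) * conv m (λ j j' → H j (suc j'))
    conv-absorb m H = begin
      ∑ (suc (suc m)) (λ j → binom (suc m) j * (fromℕ (suc m ∸ j) * H j (suc m ∸ j)))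
        ≈⟨ ∑-last (suc m) _ ⟩
      ∑ (suc m) (λ j → binom (suc m) j * (fromℕ (suc m ∸ j) * H j (suc m ∸ j)))
        + binom (suc m) (suc m) * (fromℕ (suc m ∸ suc m) * H (suc m) (suc m ∸ suc m))
        ≈⟨ +-cong (∑-cong (suc m) (λ j lt → term j (ℕP.≤-pred lt)))
                  (trans (*-congˡ (trans (*-congʳ (≡⇒≈ (≡.cong fromℕ (ℕP.n∸n≡0 m)))) (zeroˡ _))) (zeroʳ _)) ⟩
      ∑ (suc m) (λ j → fromℕ (suc m) * (binom m j * H j (suc (m ∸ j)))) + 0#
        ≈⟨ trans (+-identityʳ _) (sym (∑-*ˡ (suc m) (fromℕ (suc m)) _)) ⟩
      fromℕ (suc m) * conv m (λ j j' → H j (suc j')) ∎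
      where
      complement : ∀ j → j ℕ.≤ m → (suc m C j) ℕ.* suc (m ∸ j) ≡ suc m ℕ.* (m C j)
      complement j le =
        ≡.subst (λ M → (suc M C j) ℕ.* suc (M ∸ j) ≡ suc M ℕ.* (M C j)) (ℕP.m+[n∸m]≡n le)
          (≡.subst (λ u → (suc (j ℕ.+ (m ∸ j)) C j) ℕ.* suc u ≡ suc (j ℕ.+ (m ∸ j)) ℕ.* ((j ℕ.+ (m ∸ j)) C j))
            (≡.sym (ℕP.m+n∸m≡n j (m ∸ j))) (C-complement j (m ∸ j)))
      term : ∀ j → j ℕ.≤ m →
        binom (suc m) j * (fromℕ (suc m ∸ j) * H j (suc m ∸ j)) ≈ fromℕ (suc m) * (binom m j * H j (suc (m ∸ j)))
      term j le = begin
        binom (suc m) j * (fromℕ (suc m ∸ j) * H j (suc m ∸ j))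
          ≈⟨ *-congˡ (≡⇒≈ (≡.cong₂ (λ a b → fromℕ a * H j b) e e)) ⟩
        binom (suc m) j * (fromℕ (suc (m ∸ j)) * H j (suc (m ∸ j)))
          ≈⟨ sym (*-assoc _ _ _) ⟩
        binom (suc m) j * fromℕ (suc (m ∸ j)) * H j (suc (m ∸ j))
          ≈⟨ *-congʳ (trans (sym (fromℕ-* (suc m C j) (suc (m ∸ j))))
                        (trans (≡⇒≈ (≡.cong fromℕ (complement j le))) (fromℕ-* (suc m) (m C j)))) ⟩
        fromℕ (suc m) * binom m j * H j (suc (m ∸ j))
          ≈⟨ *-assoc _ _ _ ⟩
        fromℕ (suc m) * (binom m j * H j (suc (m ∸ j))) ∎
        where
        e : suc m ∸ j ≡ suc (m ∸ j)
        e = ℕP.+-∸-assoc 1 le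

    -- Leibniz rule: the coefficient of x^{l+1} splits by Pascal's rule
    conv-leibniz : ∀ l G → conv (suc l) G ≈ conv l (λ i i' → G (suc i) i') + conv l (λ i i' → G i (suc i'))
    conv-leibniz l G = begin
      conv (suc l) G
        ≈⟨ ∑-suc (suc l) _ ⟩
      binom (suc l) 0 * G 0 (suc l) + ∑ (suc l) (λ i → binom (suc l) (suc i) * G (suc i) (l ∸ i))
        ≈⟨ +-congˡ (∑-cong′ (suc l) (λ i → trans (*-congʳ (binom-pascal l i)) (distribʳ _ _ _))) ⟩
      binom (suc l) 0 * G 0 (suc l)
        + ∑ (suc l) (λ i → binom l i * G (suc i) (l ∸ i) + binom l (suc i) * G (suc i) (l ∸ i))
        ≈⟨ +-congˡ (∑-+ (suc l) _ _) ⟩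
      binom (suc l) 0 * G 0 (suc l) + (conv l (λ i i' → G (suc i) i') + tail)
        ≈⟨ solve 3 (λ a b x → a :+ (b :+ x) := b :+ (a :+ x)) refl _ _ _ ⟩
      conv l (λ i i' → G (suc i) i') + (binom (suc l) 0 * G 0 (suc l) + tail)
        ≈⟨ +-congˡ (+-cong (*-congʳ (trans (binom-zero (suc l)) (sym (binom-zero l)))) tail≈) ⟩
      conv l (λ i i' → G (suc i) i')
        + (binom l 0 * G 0 (suc l) + ∑ l (λ i → binom l (suc i) * G (suc i) (suc (l ∸ suc i))))
        ≈⟨ +-congˡ (sym (∑-suc l (λ i → binom l i * G i (suc (l ∸ i))))) ⟩
      conv l (λ i i' → G (suc i) i') + conv l (λ i i' → G i (suc i')) ∎
      where
      tail : Carrier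
      tail = ∑ (suc l) (λ i → binom l (suc i) * G (suc i) (l ∸ i))
      tail≈ : tail ≈ ∑ l (λ i → binom l (suc i) * G (suc i) (suc (l ∸ suc i)))
      tail≈ = begin
        tail
          ≈⟨ ∑-last l _ ⟩
        ∑ l (λ i → binom l (suc i) * G (suc i) (l ∸ i)) + binom l (suc l) * G (suc l) (l ∸ l)
          ≈⟨ +-congˡ (trans (*-congʳ (binom-big l (suc l) (ℕP.n<1+n l))) (zeroˡ _)) ⟩
        ∑ l (λ i → binom l (suc i) * G (suc i) (l ∸ i)) + 0#
          ≈⟨ +-identityʳ _ ⟩
        ∑ l (λ i → binom l (suc i) * G (suc i) (l ∸ i))
          ≈⟨ ∑-cong l (λ i lt → *-congˡ (≡⇒≈ (≡.cong (G (suc i)) (ℕP.+-∸-assoc 1 lt)))) ⟩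
        ∑ l (λ i → binom l (suc i) * G (suc i) (suc (l ∸ suc i))) ∎

-- Algebra of exponential power series in x, y, z (coefficient functions
-- Series = ℕ → ℕ → ℕ → R): coefficient-wise equality, sum, the coordinate
-- derivatives ∂x, ∂y, ∂z (shifts of the coefficient sequence), and the laws
-- of the product ⊛: congruence, bilinearity and the Leibniz rules.
module SeriesAlgebra {c ℓ} (R : CommutativeRing c ℓ) where

  open import Data.Nat using (suc; _∸_)
  open import Level using (_⊔_)
  open RingArithmetic R
  open FiniteSums R
  open Convolution R

  infix 4 _≐_
  _≐_ : Series → Series → Set ℓ
  s ≐ t = ∀ l m n → s l m n ≈ t l m n

  ≐-refl : ∀ {s} → s ≐ s
  ≐-refl l m n = refl

  ≐-trans : ∀ {s t u} → s ≐ t → t ≐ u → s ≐ u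
  ≐-trans h h' l m n = trans (h l m n) (h' l m n)

  infixl 6 _⊕_
  _⊕_ : Series → Series → Series
  (s ⊕ t) l m n = s l m n + t l m n

  0S : Series
  0S _ _ _ = 0#

  ∂x ∂y ∂z : Series → Series
  ∂x s l m n = s (suc l) m n
  ∂y s l m n = s l (suc m) n
  ∂z s l m n = s l m (suc n)

  conv3 : Series → Series → Series
  conv3 s t l m n = conv l (λ i i' → conv m (λ j j' → conv n (λ k k' → s i j k * t i' j' k')))

  ⊛≈conv3 : ∀ s t → s ⊛ t ≐ conv3 s t
  ⊛≈conv3 s t l m n = begin
    sumTo l (λ i → sumTo m (λ j → sumTo n (λ k → T i j k)))
      ≈⟨ sumTo≈∑ l _ ⟩
    ∑ (suc l) (λ i → sumTo m (λ j → sumTo n (λ k → T i j k)))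
      ≈⟨ ∑-cong′ (suc l) (λ i → trans (sumTo≈∑ m _) (∑-cong′ (suc m) (λ j → sumTo≈∑ n _))) ⟩
    ∑ (suc l) (λ i → ∑ (suc m) (λ j → ∑ (suc n) (λ k → T i j k)))
      ≈⟨ ∑-cong′ (suc l) factor ⟩
    ∑ (suc l) (λ i → binom l i * ∑ (suc m) (λ j → binom m j * ∑ (suc n) (λ k → X i j k)))
      ≈⟨ sym (trans (conv-def l _) (∑-cong′ (suc l) (λ i → *-congˡ
           (trans (conv-def m _) (∑-cong′ (suc m) (λ j → *-congˡ (conv-def n _))))))) ⟩
    conv3 s t l m n ∎
    where
    T X : ℕ → ℕ → ℕ → Carrier
    T i j k = binom l i * binom m j * binom n k * s i j k * t (l ∸ i) (m ∸ j) (n ∸ k)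
    X i j k = binom n k * (s i j k * t (l ∸ i) (m ∸ j) (n ∸ k))
    factor : ∀ i → ∑ (suc m) (λ j → ∑ (suc n) (λ k → T i j k))
                   ≈ binom l i * ∑ (suc m) (λ j → binom m j * ∑ (suc n) (λ k → X i j k))
    factor i = begin
      ∑ (suc m) (λ j → ∑ (suc n) (λ k → T i j k))
        ≈⟨ ∑-cong′ (suc m) (λ j → ∑-cong′ (suc n) (λ k →
             solve 5 (λ a b x y z → a :* b :* x :* y :* z := a :* (b :* (x :* (y :* z)))) refl _ _ _ _ _)) ⟩
      ∑ (suc m) (λ j → ∑ (suc n) (λ k → binom l i * (binom m j * X i j k)))
        ≈⟨ ∑-cong′ (suc m) (λ j → sym (∑-*ˡ (suc n) (binom l i) _)) ⟩
      ∑ (suc m) (λ j → binom l i * ∑ (suc n) (λ k → binom m j * X i j k))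
        ≈⟨ sym (∑-*ˡ (suc m) (binom l i) _) ⟩
      binom l i * ∑ (suc m) (λ j → ∑ (suc n) (λ k → binom m j * X i j k))
        ≈⟨ *-congˡ (∑-cong′ (suc m) (λ j → sym (∑-*ˡ (suc n) (binom m j) _))) ⟩
      binom l i * ∑ (suc m) (λ j → binom m j * ∑ (suc n) (λ k → X i j k)) ∎

  IsDerivation : (Series → Series) → Set (c ⊔ ℓ)
  IsDerivation D = ∀ s t → D (s ⊛ t) ≐ D s ⊛ t ⊕ s ⊛ D t

  -- ∂x, ∂y, ∂z are derivations: each reduces to conv-leibniz in its variable
  ∂x-derivation : IsDerivation ∂x
  ∂x-derivation s t l m n =
    trans (⊛≈conv3 s t (suc l) m n)
      (trans (conv-leibniz l _) (sym (+-cong (⊛≈conv3 (∂x s) t l m n) (⊛≈conv3 s (∂x t) l m n))))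

  ∂y-derivation : IsDerivation ∂y
  ∂y-derivation s t l m n = begin
    (s ⊛ t) l (suc m) n
      ≈⟨ ⊛≈conv3 s t l (suc m) n ⟩
    conv3 s t l (suc m) n
      ≈⟨ conv-swap l (suc m) _ ⟩
    conv (suc m) (λ j j' → conv l (λ i i' → K s t i i' j j'))
      ≈⟨ conv-leibniz m _ ⟩
    conv m (λ j j' → conv l (λ i i' → K s t i i' (suc j) j'))
      + conv m (λ j j' → conv l (λ i i' → K s t i i' j (suc j')))
      ≈⟨ +-cong (sym (conv-swap l m _)) (sym (conv-swap l m _)) ⟩
    conv3 (∂y s) t l m n + conv3 s (∂y t) l m n
      ≈⟨ sym (+-cong (⊛≈conv3 (∂y s) t l m n) (⊛≈conv3 s (∂y t) l m n)) ⟩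
    (∂y s ⊛ t) l m n + (s ⊛ ∂y t) l m n ∎
    where
    K : Series → Series → ℕ → ℕ → ℕ → ℕ → Carrier
    K s t i i' j j' = conv n (λ k k' → s i j k * t i' j' k')

  ∂z-derivation : IsDerivation ∂z
  ∂z-derivation s t l m n = begin
    (s ⊛ t) l m (suc n)
      ≈⟨ ⊛≈conv3 s t l m (suc n) ⟩
    conv3 s t l m (suc n)
      ≈⟨ z-outermost s t (suc n) ⟩
    conv (suc n) (λ k k' → K s t k k')
      ≈⟨ conv-leibniz n _ ⟩
    conv n (λ k k' → K s t (suc k) k') + conv n (λ k k' → K s t k (suc k'))
      ≈⟨ +-cong (sym (z-outermost (∂z s) t n)) (sym (z-outermost s (∂z t) n)) ⟩
    conv3 (∂z s) t l m n + conv3 s (∂z t) l m n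
      ≈⟨ sym (+-cong (⊛≈conv3 (∂z s) t l m n) (⊛≈conv3 s (∂z t) l m n)) ⟩
    (∂z s ⊛ t) l m n + (s ⊛ ∂z t) l m n ∎
    where
    K : Series → Series → ℕ → ℕ → Carrier
    K s t k k' = conv l (λ i i' → conv m (λ j j' → s i j k * t i' j' k'))
    z-outermost : ∀ s t n' → conv3 s t l m n' ≈ conv n' (λ k k' → K s t k k')
    z-outermost s t n' = trans (conv-cong l (λ i i' → conv-swap m n' _)) (conv-swap l n' _)

  conv3-cong : ∀ l m n {F G : ℕ → ℕ → ℕ → ℕ → ℕ → ℕ → Carrier} →
    (∀ i i' j j' k k' → F i i' j j' k k' ≈ G i i' j j' k k') →
    conv l (λ i i' → conv m (λ j j' → conv n (λ k k' → F i i' j j' k k')))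
      ≈ conv l (λ i i' → conv m (λ j j' → conv n (λ k k' → G i i' j j' k k')))
  conv3-cong l m n h = conv-cong l (λ i i' → conv-cong m (λ j j' → conv-cong n (λ k k' → h i i' j j' k k')))

  conv3-+ : ∀ l m n (F G : ℕ → ℕ → ℕ → ℕ → ℕ → ℕ → Carrier) →
    conv l (λ i i' → conv m (λ j j' → conv n (λ k k' → F i i' j j' k k' + G i i' j j' k k')))
      ≈ conv l (λ i i' → conv m (λ j j' → conv n (λ k k' → F i i' j j' k k')))
        + conv l (λ i i' → conv m (λ j j' → conv n (λ k k' → G i i' j j' k k')))
  conv3-+ l m n F G =
    trans (conv-cong l (λ i i' → trans (conv-cong m (λ j j' → conv-+ n _ _)) (conv-+ m _ _))) (conv-+ l _ _)

  conv3-* : ∀ l m n x (F : ℕ → ℕ → ℕ → ℕ → ℕ → ℕ → Carrier) →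
    conv l (λ i i' → conv m (λ j j' → conv n (λ k k' → x * F i i' j j' k k')))
      ≈ x * conv l (λ i i' → conv m (λ j j' → conv n (λ k k' → F i i' j j' k k')))
  conv3-* l m n x F =
    trans (conv-cong l (λ i i' → trans (conv-cong m (λ j j' → conv-* n x _)) (conv-* m x _))) (conv-* l x _)

  ⊛-cong : ∀ {s s' t t'} → s ≐ s' → t ≐ t' → s ⊛ t ≐ s' ⊛ t'
  ⊛-cong {s} {s'} {t} {t'} hs ht l m n =
    trans (⊛≈conv3 s t l m n)
      (trans (conv3-cong l m n (λ i i' j j' k k' → *-cong (hs i j k) (ht i' j' k')))
        (sym (⊛≈conv3 s' t' l m n)))

  ⊛-congˡ : ∀ {s s'} t → s ≐ s' → s ⊛ t ≐ s' ⊛ t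
  ⊛-congˡ t hs = ⊛-cong hs (≐-refl {t})

  ⊛-congʳ : ∀ s {t t'} → t ≐ t' → s ⊛ t ≐ s ⊛ t'
  ⊛-congʳ s ht = ⊛-cong (≐-refl {s}) ht

  ⊛-distribˡ : ∀ s t t' → s ⊛ (t ⊕ t') ≐ s ⊛ t ⊕ s ⊛ t'
  ⊛-distribˡ s t t' l m n =
    trans (⊛≈conv3 s (t ⊕ t') l m n)
      (trans (conv3-cong l m n (λ i i' j j' k k' → distribˡ (s i j k) (t i' j' k') (t' i' j' k')))
        (trans (conv3-+ l m n _ _) (sym (+-cong (⊛≈conv3 s t l m n) (⊛≈conv3 s t' l m n)))))

  ⊛-distribʳ : ∀ s s' t → (s ⊕ s') ⊛ t ≐ s ⊛ t ⊕ s' ⊛ t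
  ⊛-distribʳ s s' t l m n =
    trans (⊛≈conv3 (s ⊕ s') t l m n)
      (trans (conv3-cong l m n (λ i i' j j' k k' → distribʳ (t i' j' k') (s i j k) (s' i j k)))
        (trans (conv3-+ l m n _ _) (sym (+-cong (⊛≈conv3 s t l m n) (⊛≈conv3 s' t l m n)))))

  ⊛-scaleʳ : ∀ x s t → s ⊛ scale x t ≐ scale x (s ⊛ t)
  ⊛-scaleʳ x s t l m n =
    trans (⊛≈conv3 s (scale x t) l m n)
      (trans (conv3-cong l m n (λ i i' j j' k k' →
                solve 3 (λ a b y → a :* (b :* y) := b :* (a :* y)) refl (s i j k) x (t i' j' k')))
        (trans (conv3-* l m n x _) (*-congˡ (sym (⊛≈conv3 s t l m n)))))

  ⊛-scaleˡ : ∀ x s t → scale x s ⊛ t ≐ scale x (s ⊛ t)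
  ⊛-scaleˡ x s t l m n =
    trans (⊛≈conv3 (scale x s) t l m n)
      (trans (conv3-cong l m n (λ i i' j j' k k' → *-assoc x (s i j k) (t i' j' k')))
        (trans (conv3-* l m n x _) (*-congˡ (sym (⊛≈conv3 s t l m n)))))

  ⊛-zeroˡ : ∀ t → 0S ⊛ t ≐ 0S
  ⊛-zeroˡ t l m n =
    trans (⊛≈conv3 0S t l m n)
      (conv-0 l (λ i i' _ → conv-0 m (λ j j' _ → conv-0 n (λ k k' _ → zeroˡ _))))

  ⊛-zeroʳ : ∀ s → s ⊛ 0S ≐ 0S
  ⊛-zeroʳ s l m n =
    trans (⊛≈conv3 s 0S l m n)
      (conv-0 l (λ i i' _ → conv-0 m (λ j j' _ → conv-0 n (λ k k' _ → zeroʳ _))))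

  derivation-⊛³ : ∀ {D} → IsDerivation D → ∀ p u v →
    D ((p ⊛ u) ⊛ v) ≐ (D p ⊛ u) ⊛ v ⊕ (p ⊛ D u) ⊛ v ⊕ (p ⊛ u) ⊛ D v
  derivation-⊛³ {D} leib p u v l m n =
    trans (leib (p ⊛ u) v l m n)
      (+-congʳ (trans (⊛-congˡ v (leib p u) l m n) (⊛-distribʳ (D p ⊛ u) (p ⊛ D u) v l m n)))

  derivation-eigen : ∀ {D} → IsDerivation D → ∀ κ e → D e ≐ scale κ e →
                     ∀ s → D (e ⊛ s) ≐ e ⊛ (scale κ s ⊕ D s)
  derivation-eigen {D} leib κ e De s l m n = begin
    D (e ⊛ s) l m n
      ≈⟨ leib e s l m n ⟩
    (D e ⊛ s) l m n + (e ⊛ D s) l m n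
      ≈⟨ +-congʳ (trans (⊛-congˡ s De l m n) (trans (⊛-scaleˡ κ e s l m n) (sym (⊛-scaleʳ κ e s l m n)))) ⟩
    (e ⊛ scale κ s) l m n + (e ⊛ D s) l m n
      ≈⟨ sym (⊛-distribˡ e (scale κ s) (D s) l m n) ⟩
    (e ⊛ (scale κ s ⊕ D s)) l m n ∎

  ⊛-annihilatesˡ : ∀ {s} t → s ≐ 0S → s ⊛ t ≐ 0S
  ⊛-annihilatesˡ t h = ≐-trans (⊛-congˡ t h) (⊛-zeroˡ t)

  ⊛-annihilatesʳ : ∀ s {t} → t ≐ 0S → s ⊛ t ≐ 0S
  ⊛-annihilatesʳ s h = ≐-trans (⊛-congʳ s h) (⊛-zeroʳ s)

  scale-middle : ∀ p {u u'} v x → u ≐ scale x u' → (p ⊛ u) ⊛ v ≐ scale x ((p ⊛ u') ⊛ v)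
  scale-middle p {u} {u'} v x h =
    ≐-trans (⊛-congˡ v (≐-trans (⊛-congʳ p h) (⊛-scaleʳ x p u'))) (⊛-scaleˡ x (p ⊛ u') v)

  scale-last : ∀ p u {v v'} x → v ≐ scale x v' → (p ⊛ u) ⊛ v ≐ scale x ((p ⊛ u) ⊛ v')
  scale-last p u {v} {v'} x h = ≐-trans (⊛-congʳ (p ⊛ u) h) (⊛-scaleʳ x (p ⊛ u) v')

module ElementarySeries {c ℓ} (R : CommutativeRing c ℓ) where

  open import Data.Bool using (true; false)
  open import Data.Nat as ℕ using (zero; suc; _≡ᵇ_)
  import Data.Nat.Properties as ℕP
  open import Relation.Binary.PropositionalEquality as ≡ using (_≡_)
  open RingArithmetic R
  open Convolution R
  open SeriesAlgebra R

  rising-cong : ∀ {e e'} K → e ≈ e' → rising e K ≈ rising e' K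
  rising-cong zero    h = refl
  rising-cong (suc K) h = *-cong (rising-cong K h) (+-congʳ h)

  rising-suc : ∀ e K → rising e (suc K) ≈ e * rising (1# + e) K
  rising-suc e zero = solve 1 (λ e → con (ℤ.+ 1) :* (e :+ con (ℤ.+ 0)) := e :* con (ℤ.+ 1)) refl e
    where import Data.Integer as ℤ
  rising-suc e (suc K) = begin
    rising e (suc K) * (e + (1# + fromℕ K))
      ≈⟨ *-congʳ (rising-suc e K) ⟩
    e * rising (1# + e) K * (e + (1# + fromℕ K))
      ≈⟨ solve 4 (λ e r k o → e :* r :* (e :+ (o :+ k)) := e :* (r :* ((o :+ e) :+ k))) refl e _ (fromℕ K) 1# ⟩
    e * (rising (1# + e) K * ((1# + e) + fromℕ K)) ∎

  binomLin-cong : ∀ {e e'} a b c' → e ≈ e' → binomLin e a b c' ≐ binomLin e' a b c'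
  binomLin-cong a b c' h i j k = *-congʳ (*-congʳ (*-congʳ (rising-cong (i ℕ.+ j ℕ.+ k) h)))

  ∂x-binomLin : ∀ e a b c' → ∂x (binomLin e a b c') ≐ scale (- a * e) (binomLin (1# + e) a b c')
  ∂x-binomLin e a b c' i j k =
    trans (*-congʳ (*-congʳ (*-congʳ (rising-suc e (i ℕ.+ j ℕ.+ k)))))
      (solve 6 (λ e r x ai bj ck → e :* r :* (x :* ai) :* bj :* ck := x :* e :* (r :* ai :* bj :* ck))
         refl e _ (- a) _ _ _)

  ∂y-binomLin : ∀ e a b c' → ∂y (binomLin e a b c') ≐ scale (- b * e) (binomLin (1# + e) a b c')
  ∂y-binomLin e a b c' i j k =
    trans (*-congʳ (*-congʳ (*-congʳ (trans (≡⇒≈ (≡.cong (rising e) degree)) (rising-suc e (i ℕ.+ j ℕ.+ k))))))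
      (solve 6 (λ e r x ai bj ck → e :* r :* ai :* (x :* bj) :* ck := x :* e :* (r :* ai :* bj :* ck))
         refl e _ (- b) _ _ _)
    where
    degree : i ℕ.+ suc j ℕ.+ k ≡ suc (i ℕ.+ j ℕ.+ k)
    degree = ≡.cong (ℕ._+ k) (ℕP.+-suc i j)

  ∂z-binomLin : ∀ e a b c' → ∂z (binomLin e a b c') ≐ scale (- c' * e) (binomLin (1# + e) a b c')
  ∂z-binomLin e a b c' i j k =
    trans (*-congʳ (*-congʳ (*-congʳ (trans (≡⇒≈ (≡.cong (rising e) degree)) (rising-suc e (i ℕ.+ j ℕ.+ k))))))
      (solve 6 (λ e r x ai bj ck → e :* r :* ai :* bj :* (x :* ck) := x :* e :* (r :* ai :* bj :* ck))
         refl e _ (- c') _ _ _)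
    where
    degree : i ℕ.+ j ℕ.+ suc k ≡ suc (i ℕ.+ j ℕ.+ k)
    degree = ℕP.+-suc (i ℕ.+ j) k

  scale-by-0 : ∀ {x} s → x ≈ 0# → scale x s ≐ 0S
  scale-by-0 s h i j k = trans (*-congʳ h) (zeroˡ _)

  -0*e≈0 : ∀ e → - 0# * e ≈ 0#
  -0*e≈0 e = trans (*-congʳ -0#≈0#) (zeroˡ e)

  ∂y-binomLin-free : ∀ e a c' → ∂y (binomLin e a 0# c') ≐ 0S
  ∂y-binomLin-free e a c' = ≐-trans (∂y-binomLin e a 0# c') (scale-by-0 _ (-0*e≈0 e))

  ∂z-binomLin-free : ∀ e a b → ∂z (binomLin e a b 0#) ≐ 0S
  ∂z-binomLin-free e a b = ≐-trans (∂z-binomLin e a b 0#) (scale-by-0 _ (-0*e≈0 e))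

  ∂x-expLin : ∀ a b c' → ∂x (expLin a b c') ≐ scale a (expLin a b c')
  ∂x-expLin a b c' i j k = solve 4 (λ a x y z → a :* x :* y :* z := a :* (x :* y :* z)) refl a _ _ _

  ∂y-expLin : ∀ a b c' → ∂y (expLin a b c') ≐ scale b (expLin a b c')
  ∂y-expLin a b c' i j k = solve 4 (λ b x y z → x :* (b :* y) :* z := b :* (x :* y :* z)) refl b _ _ _

  ∂z-expLin : ∀ a b c' → ∂z (expLin a b c') ≐ scale c' (expLin a b c')
  ∂z-expLin a b c' i j k = solve 4 (λ c x y z → x :* y :* (c :* z) := c :* (x :* y :* z)) refl c' _ _ _

  ∂x-xPow/!0 : ∂x (xPow/! 0) ≐ 0S
  ∂x-xPow/!0 l m n = refl

  ∂y-xPow/! : ∀ L → ∂y (xPow/! L) ≐ 0S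
  ∂y-xPow/! L l m n with l ≡ᵇ L
  ... | true  = refl
  ... | false = refl

  ∂z-xPow/! : ∀ L → ∂z (xPow/! L) ≐ 0S
  ∂z-xPow/! L l m n with l ≡ᵇ L | m ≡ᵇ 0
  ... | true  | true  = refl
  ... | true  | false = refl
  ... | false | _     = refl

  xPow/!0-unit : ∀ t → xPow/! 0 ⊛ t ≐ t
  xPow/!0-unit t l m n = begin
    (xPow/! 0 ⊛ t) l m n
      ≈⟨ ⊛≈conv3 (xPow/! 0) t l m n ⟩
    conv3 (xPow/! 0) t l m n
      ≈⟨ conv-first l (λ i i' → conv-0 m (λ j j' _ → conv-0 n (λ k k' _ → zeroˡ _))) ⟩
    conv m (λ j j' → conv n (λ k k' → xPow/! 0 0 j k * t l j' k'))
      ≈⟨ conv-first m (λ j j' → conv-0 n (λ k k' _ → zeroˡ _)) ⟩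
    conv n (λ k k' → xPow/! 0 0 0 k * t l m k')
      ≈⟨ conv-first n (λ k k' → zeroˡ _) ⟩
    1# * t l m n
      ≈⟨ *-identityˡ _ ⟩
    t l m n ∎

  DivisibleByX^ : ℕ → Series → Set ℓ
  DivisibleByX^ L s = ∀ i j k → i ℕ.< L → s i j k ≈ 0#

  <⇒≡ᵇ-false : ∀ i L → i ℕ.< L → (i ≡ᵇ L) ≡ false
  <⇒≡ᵇ-false zero    (suc L) lt         = ≡.refl
  <⇒≡ᵇ-false (suc i) (suc L) (ℕ.s≤s lt) = <⇒≡ᵇ-false i L lt

  xPow/!-divisible : ∀ L → DivisibleByX^ L (xPow/! L)
  xPow/!-divisible L i j k lt rewrite <⇒≡ᵇ-false i L lt = refl

  scale-divisible : ∀ L x s → DivisibleByX^ L s → DivisibleByX^ L (scale x s)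
  scale-divisible L x s h i j k lt = trans (*-congˡ (h i j k lt)) (zeroʳ x)

  ⊛-divisible : ∀ L s t → DivisibleByX^ L s → DivisibleByX^ L (s ⊛ t)
  ⊛-divisible L s t h l m n lt =
    trans (⊛≈conv3 s t l m n)
      (conv-0 l (λ i i' i≤l → conv-0 m (λ j j' _ → conv-0 n (λ k k' _ →
        trans (*-congʳ (h i j k (ℕP.≤-<-trans i≤l lt))) (zeroˡ _)))))

-- The key step is the PDE  ∂y∂z inner = ∂x inner + β ∂y inner + α ∂z inner:
-- the PDE defect of the l-th summand is a difference of consecutive terms
-- of one sequence, so the defect of the sum telescopes to a term of x-order
-- above the degree considered.
module RightHandSide {c ℓ} (R : CommutativeRing c ℓ) (α β : CommutativeRing.Carrier R) where

  open import Data.Nat using (zero; suc)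
  import Data.Nat.Properties as ℕP
  open RingArithmetic R
  open FiniteSums R
  open SeriesAlgebra R
  open ElementarySeries R

  Ay Bz : Carrier → Series
  Ay e = binomLin e β (- 1#) 0#
  Bz f = binomLin f α 0# (- 1#)

  term : ℕ → Carrier → Carrier → Series
  term l e f = (xPow/! l ⊛ Ay e) ⊛ Bz f

  weight : ℕ → Carrier
  weight l = rising α l * rising β l

  summand : ℕ → Series
  summand l = scale (weight l) (term l (fromℕ l + α) (fromℕ l + β))

  inner : Series
  inner = sumX summand

  expFactor : Series
  expFactor = expLin (α * β) (- α) (- β)

  -- ∂y and ∂z only see the corresponding binomial factor
  ∂y-term : ∀ l e f → ∂y (term l e f) ≐ scale (- (- 1#) * e) (term l (1# + e) f)
  ∂y-term l e f i j k =
    trans (derivation-⊛³ ∂y-derivation (xPow/! l) (Ay e) (Bz f) i j k)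
      (trans (+-cong (+-cong monomial middle) last) (trans (+-identityʳ _) (+-identityˡ _)))
    where
    monomial : ((∂y (xPow/! l) ⊛ Ay e) ⊛ Bz f) i j k ≈ 0#
    monomial = ⊛-annihilatesˡ (Bz f) (⊛-annihilatesˡ (Ay e) (∂y-xPow/! l)) i j k
    middle : ((xPow/! l ⊛ ∂y (Ay e)) ⊛ Bz f) i j k ≈ scale (- (- 1#) * e) (term l (1# + e) f) i j k
    middle = scale-middle (xPow/! l) (Bz f) _ (∂y-binomLin e β (- 1#) 0#) i j k
    last : ((xPow/! l ⊛ Ay e) ⊛ ∂y (Bz f)) i j k ≈ 0#
    last = ⊛-annihilatesʳ (xPow/! l ⊛ Ay e) (∂y-binomLin-free f α (- 1#)) i j k

  ∂z-term : ∀ l e f → ∂z (term l e f) ≐ scale (- (- 1#) * f) (term l e (1# + f))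
  ∂z-term l e f i j k =
    trans (derivation-⊛³ ∂z-derivation (xPow/! l) (Ay e) (Bz f) i j k)
      (trans (+-cong (trans (+-cong monomial middle) (+-identityʳ 0#)) last) (+-identityˡ _))
    where
    monomial : ((∂z (xPow/! l) ⊛ Ay e) ⊛ Bz f) i j k ≈ 0#
    monomial = ⊛-annihilatesˡ (Bz f) (⊛-annihilatesˡ (Ay e) (∂z-xPow/! l)) i j k
    middle : ((xPow/! l ⊛ ∂z (Ay e)) ⊛ Bz f) i j k ≈ 0#
    middle = ⊛-annihilatesˡ (Bz f) (⊛-annihilatesʳ (xPow/! l) (∂z-binomLin-free e β (- 1#))) i j k
    last : ((xPow/! l ⊛ Ay e) ⊛ ∂z (Bz f)) i j k ≈ scale (- (- 1#) * f) (term l e (1# + f)) i j k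
    last = scale-last (xPow/! l) (Ay e) _ (∂z-binomLin f α 0# (- 1#)) i j k

  ∂x-term : ∀ l e f i j k →
    ∂x (term l e f) i j k ≈ ((∂x (xPow/! l) ⊛ Ay e) ⊛ Bz f) i j k
                            + (- β * e) * term l (1# + e) f i j k + (- α * f) * term l e (1# + f) i j k
  ∂x-term l e f i j k =
    trans (derivation-⊛³ ∂x-derivation (xPow/! l) (Ay e) (Bz f) i j k)
      (+-cong (+-congˡ (scale-middle (xPow/! l) (Bz f) _ (∂x-binomLin e β (- 1#) 0#) i j k))
              (scale-last (xPow/! l) (Ay e) _ (∂x-binomLin f α 0# (- 1#)) i j k))

  defect : Series → ℕ → ℕ → ℕ → Carrier
  defect s L M N = s L (suc M) (suc N) - β * s L (suc M) N - α * s L M (suc N) - s (suc L) M N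

  raised : ℕ → Series
  raised l = scale (weight (suc l)) (term l (fromℕ (suc l) + α) (fromℕ (suc l) + β))

  weight-raise : ∀ l L M N →
    weight l * (fromℕ l + α) * (fromℕ l + β) * term l (1# + (fromℕ l + α)) (1# + (fromℕ l + β)) L M N
      ≈ raised l L M N
  weight-raise l L M N =
    trans (*-congˡ (⊛-cong (⊛-congʳ (xPow/! l) (binomLin-cong β (- 1#) 0# (sym (+-assoc _ _ _))))
                           (binomLin-cong α 0# (- 1#) (sym (+-assoc _ _ _))) L M N))
      (solve 6 (λ ra rb x q a b → ra :* rb :* (x :+ a) :* (x :+ b) :* q := ra :* (a :+ x) :* (rb :* (b :+ x)) :* q)
         refl (rising α l) (rising β l) (fromℕ l) _ α β)

  monomial-derivative : ∀ l L M N →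
    weight l * ((∂x (xPow/! l) ⊛ Ay (fromℕ l + α)) ⊛ Bz (fromℕ l + β)) L M N
      ≈ previous (λ l' → raised l' L M N) l
  monomial-derivative zero L M N =
    trans (*-congˡ (⊛-annihilatesˡ (Bz (0# + β)) (⊛-annihilatesˡ (Ay (0# + α)) ∂x-xPow/!0) L M N)) (zeroʳ _)
  monomial-derivative (suc l) L M N = refl

  defect-summand : ∀ l L M N → defect (summand l) L M N ≈ raised l L M N - previous (λ l' → raised l' L M N) l
  defect-summand l L M N = begin
    defect (summand l) L M N
      ≈⟨ +-cong (+-cong (+-cong (*-congˡ yz) (-‿cong (*-congˡ (*-congˡ y)))) (-‿cong (*-congˡ (*-congˡ z))))
                (-‿cong (*-congˡ x)) ⟩
    w * (u f * (u e * Q11)) - β * (w * (u e * Q10)) - α * (w * (u f * Q01))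
      - w * (X0 + (- β * e) * Q10 + (- α * f) * Q01)
      ≈⟨ solve 9 (λ w e f q11 q10 q01 x0 a b →
             w :* ((:- (:- con (ℤ.+ 1)) :* f) :* ((:- (:- con (ℤ.+ 1)) :* e) :* q11))
               :+ :- (b :* (w :* ((:- (:- con (ℤ.+ 1)) :* e) :* q10)))
               :+ :- (a :* (w :* ((:- (:- con (ℤ.+ 1)) :* f) :* q01))) :+ :- (w :* (x0 :+ (:- b :* e) :* q10 :+ (:- a :* f) :* q01))
             := w :* e :* f :* q11 :+ :- (w :* x0)) refl w e f Q11 Q10 Q01 X0 α β ⟩
    w * e * f * Q11 - w * X0
      ≈⟨ +-cong (weight-raise l L M N) (-‿cong (monomial-derivative l L M N)) ⟩
    raised l L M N - previous (λ l' → raised l' L M N) l ∎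
    where
    import Data.Integer as ℤ
    u : Carrier → Carrier
    u x = - (- 1#) * x
    w e f Q11 Q10 Q01 X0 : Carrier
    w = weight l
    e = fromℕ l + α
    f = fromℕ l + β
    Q11 = term l (1# + e) (1# + f) L M N
    Q10 = term l (1# + e) f L M N
    Q01 = term l e (1# + f) L M N
    X0 = ((∂x (xPow/! l) ⊛ Ay e) ⊛ Bz f) L M N
    yz : term l e f L (suc M) (suc N) ≈ u f * (u e * Q11)
    yz = trans (∂z-term l e f L (suc M) N) (*-congˡ (∂y-term l e (1# + f) L M N))
    y : term l e f L (suc M) N ≈ u e * Q10
    y = ∂y-term l e f L M N
    z : term l e f L M (suc N) ≈ u f * Q01
    z = ∂z-term l e f L M N
    x : term l e f (suc L) M N ≈ X0 + (- β * e) * Q10 + (- α * f) * Q01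
    x = ∂x-term l e f L M N

  summand-divisible : ∀ l → DivisibleByX^ l (summand l)
  summand-divisible l =
    scale-divisible l (weight l) _ (⊛-divisible l _ _ (⊛-divisible l _ _ (xPow/!-divisible l)))

  raised-divisible : ∀ l → DivisibleByX^ l (raised l)
  raised-divisible l =
    scale-divisible l (weight (suc l)) _ (⊛-divisible l _ _ (⊛-divisible l _ _ (xPow/!-divisible l)))

  inner-extended : ∀ L M N → inner L M N ≈ ∑ (suc (suc L)) (λ l → summand l L M N)
  inner-extended L M N = begin
    inner L M N                                           ≈⟨ sumTo≈∑ L _ ⟩
    ∑ (suc L) (λ l → summand l L M N)                     ≈⟨ sym (+-identityʳ _) ⟩
    ∑ (suc L) (λ l → summand l L M N) + 0#                ≈⟨ +-congˡ (sym (summand-divisible (suc L) L M N (ℕP.n<1+n L))) ⟩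
    ∑ (suc L) (λ l → summand l L M N) + summand (suc L) L M N ≈⟨ sym (∑-last (suc L) _) ⟩
    ∑ (suc (suc L)) (λ l → summand l L M N)               ∎

  defect-inner : ∀ L M N → defect inner L M N ≈ ∑ (suc (suc L)) (λ l → defect (summand l) L M N)
  defect-inner L M N = begin
    defect inner L M N
      ≈⟨ +-cong (+-cong (+-cong (inner-extended L (suc M) (suc N)) (-‿cong (*-congˡ (inner-extended L (suc M) N))))
                        (-‿cong (*-congˡ (inner-extended L M (suc N))))) (-‿cong (sumTo≈∑ (suc L) _)) ⟩
    ∑ n f₁ - β * ∑ n f₂ - α * ∑ n f₃ - ∑ n f₄
      ≈⟨ +-congʳ (+-cong (+-congˡ (-‿cong (∑-*ˡ n β f₂))) (-‿cong (∑-*ˡ n α f₃))) ⟩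
    ∑ n f₁ - ∑ n (λ l → β * f₂ l) - ∑ n (λ l → α * f₃ l) - ∑ n f₄
      ≈⟨ sym (trans (∑-- n _ f₄) (+-congʳ (trans (∑-- n _ _) (+-congʳ (∑-- n f₁ _))))) ⟩
    ∑ n (λ l → f₁ l - β * f₂ l - α * f₃ l - f₄ l) ∎
    where
    n : ℕ
    n = suc (suc L)
    f₁ f₂ f₃ f₄ : ℕ → Carrier
    f₁ l = summand l L (suc M) (suc N)
    f₂ l = summand l L (suc M) N
    f₃ l = summand l L M (suc N)
    f₄ l = summand l (suc L) M N

  inner-pde : ∀ L M N → inner L (suc M) (suc N) ≈ inner (suc L) M N + β * inner L (suc M) N + α * inner L M (suc N)
  inner-pde L M N = begin
    s₁
      ≈⟨ solve 6 (λ s₁ s₂ s₃ s₄ a b → s₁ := (s₁ :+ :- (b :* s₂) :+ :- (a :* s₃) :+ :- s₄) :+ (s₄ :+ b :* s₂ :+ a :* s₃))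
           refl s₁ s₂ s₃ s₄ α β ⟩
    defect inner L M N + (s₄ + β * s₂ + α * s₃)
      ≈⟨ +-congʳ defect≈0 ⟩
    0# + (s₄ + β * s₂ + α * s₃)
      ≈⟨ +-identityˡ _ ⟩
    s₄ + β * s₂ + α * s₃ ∎
    where
    s₁ s₂ s₃ s₄ : Carrier
    s₁ = inner L (suc M) (suc N)
    s₂ = inner L (suc M) N
    s₃ = inner L M (suc N)
    s₄ = inner (suc L) M N
    defect≈0 : defect inner L M N ≈ 0#
    defect≈0 = begin
      defect inner L M N
        ≈⟨ defect-inner L M N ⟩
      ∑ (suc (suc L)) (λ l → defect (summand l) L M N)
        ≈⟨ ∑-cong′ (suc (suc L)) (λ l → defect-summand l L M N) ⟩
      ∑ (suc (suc L)) (λ l → raised l L M N - previous (λ l' → raised l' L M N) l)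
        ≈⟨ telescope (suc L) (λ l → raised l L M N) ⟩
      raised (suc L) L M N
        ≈⟨ raised-divisible (suc L) L M N (ℕP.n<1+n L) ⟩
      0# ∎

  -- the z- and x-derivatives of RHS, divided by expFactor
  zPart xPart yzPart : Series
  zPart  = scale (- β) inner ⊕ ∂z inner
  xPart  = scale (α * β) inner ⊕ ∂x inner
  yzPart = scale (- α) zPart ⊕ ∂y zPart

  -- the PDE, rewritten with the exponential factors of ∂x and ∂y∂z
  xPart≐yzPart : xPart ≐ yzPart
  xPart≐yzPart l m n = begin
    (α * β) * inner l m n + inner (suc l) m n
      ≈⟨ solve 6 (λ a b s sx sy sz → (a :* b) :* s :+ sx
                    := (:- a) :* ((:- b) :* s :+ sz) :+ ((:- b) :* sy :+ (sx :+ b :* sy :+ a :* sz)))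
           refl α β (inner l m n) (inner (suc l) m n) (inner l (suc m) n) (inner l m (suc n)) ⟩
    (- α) * ((- β) * inner l m n + inner l m (suc n))
      + ((- β) * inner l (suc m) n + (inner (suc l) m n + β * inner l (suc m) n + α * inner l m (suc n)))
      ≈⟨ +-congˡ (+-congˡ (sym (inner-pde l m n))) ⟩
    (- α) * ((- β) * inner l m n + inner l m (suc n)) + ((- β) * inner l (suc m) n + inner l (suc m) (suc n)) ∎

  -- the shift relation for RHS = expFactor ⊛ inner, by the eigenvector property
  shift-relation : ∀ L M N → RHS α β (suc L) M N ≈ RHS α β L (suc M) (suc N)
  shift-relation L M N = begin
    (expFactor ⊛ inner) (suc L) M N
      ≈⟨ derivation-eigen ∂x-derivation (α * β) expFactor (∂x-expLin (α * β) (- α) (- β)) inner L M N ⟩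
    (expFactor ⊛ xPart) L M N
      ≈⟨ ⊛-congʳ expFactor xPart≐yzPart L M N ⟩
    (expFactor ⊛ yzPart) L M N
      ≈⟨ sym (derivation-eigen ∂y-derivation (- α) expFactor (∂y-expLin (α * β) (- α) (- β)) zPart L M N) ⟩
    (expFactor ⊛ zPart) L (suc M) N
      ≈⟨ sym (derivation-eigen ∂z-derivation (- β) expFactor (∂z-expLin (α * β) (- α) (- β)) inner L (suc M) N) ⟩
    (expFactor ⊛ inner) L (suc M) (suc N) ∎

-- The sequence d_a(M) = Σ_j C(M,j) (-a)^j (a)_{M-j}, the coefficient of
-- y^M/M! in e^{-ay} (1-y)^{-a}, and its recurrence
--   d_a(0) = 1,  d_a(1) = 0,  d_a(M+2) = (M+1) (d_a(M+1) + a d_a(M)),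
-- which is also the recurrence of the derangement polynomials.
module DerangementSequence {c ℓ} (R : CommutativeRing c ℓ) where

  open import Data.Nat using (suc)
  open RingArithmetic R
  open Convolution R

  d : Carrier → ℕ → Carrier
  d a M = conv M (λ j j' → (- a) ^ j * rising a j')

  d-zero : ∀ a → d a 0 ≈ 1#
  d-zero a = trans (conv-length0 _) (*-identityˡ 1#)

  d-one : ∀ a → d a 1 ≈ 0#
  d-one a =
    trans (conv-leibniz 0 (λ j j' → (- a) ^ j * rising a j'))
      (trans (+-cong (conv-length0 _) (conv-length0 _))
        (solve 1 (λ a → ((:- a) :* con (ℤ.+ 1)) :* con (ℤ.+ 1) :+ con (ℤ.+ 1) :* (con (ℤ.+ 1) :* (a :+ con (ℤ.+ 0)))
                        := con (ℤ.+ 0)) refl a))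
    where import Data.Integer as ℤ

  d-recurrence : ∀ a m → d a (suc (suc m)) ≈ fromℕ (suc m) * (d a (suc m) + a * d a m)
  d-recurrence a m = begin
    d a (suc (suc m))                    ≈⟨ d≈absorbed (suc m) ⟩
    absorbed (suc m)                     ≈⟨ conv-absorb m (λ j j' → e j * r j') ⟩
    fromℕ (suc m) * shifted m            ≈⟨ *-congˡ shifted≈ ⟩
    fromℕ (suc m) * (d a (suc m) + a * d a m) ∎
    where
    e r : ℕ → Carrier
    e j = (- a) ^ j
    r j = rising a j
    G : ℕ → ℕ → Carrier
    G j j' = e j * r j'
    shifted absorbed : ℕ → Carrier
    shifted m  = conv m (λ j j' → e j * r (suc j'))
    absorbed m = conv m (λ j j' → fromℕ j' * (e j * r j'))
    leibniz : ∀ m → d a (suc m) ≈ (- a) * d a m + shifted m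
    leibniz m =
      trans (conv-leibniz m G)
        (+-congʳ (trans (conv-cong m (λ j j' → *-assoc (- a) (e j) (r j'))) (conv-* m (- a) G)))
    -- (a)_{j'+1} = (a)_{j'} (a + j'):  shifted(m) = a d(m) + absorbed(m)
    shifted≈absorbed : ∀ m → shifted m ≈ a * d a m + absorbed m
    shifted≈absorbed m =
      trans (conv-cong m (λ j j' → solve 4 (λ x y a z → x :* (y :* (a :+ z)) := a :* (x :* y) :+ z :* (x :* y))
                                             refl (e j) (r j') a (fromℕ j')))
        (trans (conv-+ m (λ j j' → a * G j j') (λ j j' → fromℕ j' * G j j')) (+-congʳ (conv-* m a G)))
    d≈absorbed : ∀ m → d a (suc m) ≈ absorbed m
    d≈absorbed m =
      trans (leibniz m) (trans (+-congˡ (shifted≈absorbed m))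
        (solve 3 (λ a x k → (:- a) :* x :+ (a :* x :+ k) := k) refl a (d a m) (absorbed m)))
    shifted≈ : shifted m ≈ d a (suc m) + a * d a m
    shifted≈ =
      trans (solve 3 (λ x a y → x := ((:- a) :* y :+ x) :+ a :* y) refl (shifted m) a (d a m))
        (+-congʳ (sym (leibniz m)))

module RightHandSideAtZero {c ℓ} (R : CommutativeRing c ℓ) (α β : CommutativeRing.Carrier R) where

  open import Data.Nat using (zero; suc)
  import Data.Nat.Properties as ℕP
  import Relation.Binary.PropositionalEquality as ≡
  open RingArithmetic R
  open FiniteSums R
  open Convolution R
  open SeriesAlgebra R
  open ElementarySeries R
  open DerangementSequence R
  open RightHandSide R α β

  neg-neg-1^ : ∀ n → (- (- 1#)) ^ n ≈ 1#
  neg-neg-1^ zero    = refl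
  neg-neg-1^ (suc n) = trans (*-cong (-‿involutive 1#) (neg-neg-1^ n)) (*-identityˡ 1#)

  neg-0^suc : ∀ n → (- 0#) ^ suc n ≈ 0#
  neg-0^suc n = trans (*-congʳ -0#≈0#) (zeroˡ _)

  AyBz-at-x0 : ∀ e f j k → (Ay e ⊛ Bz f) 0 j k ≈ rising e j * rising f k
  AyBz-at-x0 e f j k = begin
    (Ay e ⊛ Bz f) 0 j k
      ≈⟨ ⊛≈conv3 (Ay e) (Bz f) 0 j k ⟩
    conv3 (Ay e) (Bz f) 0 j k
      ≈⟨ conv-length0 _ ⟩
    conv j (λ j₁ j₂ → conv k (λ k₁ k₂ → Ay e 0 j₁ k₁ * Bz f 0 j₂ k₂))
      ≈⟨ conv-cong j (λ j₁ j₂ → conv-first k (λ k₁ k₂ → trans (*-congʳ (trans (*-congˡ (neg-0^suc k₁)) (zeroʳ _))) (zeroˡ _))) ⟩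
    conv j (λ j₁ j₂ → Ay e 0 j₁ 0 * Bz f 0 j₂ k)
      ≈⟨ conv-last j (λ j₁ j₂ → trans (*-congˡ (trans (*-congʳ (trans (*-congˡ (neg-0^suc j₂)) (zeroʳ _))) (zeroˡ _))) (zeroʳ _)) ⟩
    Ay e 0 j 0 * Bz f 0 0 k
      ≈⟨ *-cong Ay-axis Bz-axis ⟩
    rising e j * rising f k ∎
    where
    Ay-axis : Ay e 0 j 0 ≈ rising e j
    Ay-axis = trans (*-identityʳ _) (trans (*-congˡ (neg-neg-1^ j))
                (trans (*-identityʳ _) (trans (*-identityʳ _) (≡⇒≈ (≡.cong (rising e) (ℕP.+-identityʳ j))))))
    Bz-axis : Bz f 0 0 k ≈ rising f k
    Bz-axis = trans (*-congˡ (neg-neg-1^ k)) (trans (*-identityʳ _) (trans (*-identityʳ _) (*-identityʳ _)))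

  -- only the summand l = 0 contributes at x-degree 0
  inner-at-x0 : ∀ j k → inner 0 j k ≈ rising α j * rising β k
  inner-at-x0 j k = begin
    inner 0 j k
      ≈⟨ sumTo≈∑ 0 (λ l → summand l 0 j k) ⟩
    ∑ 1 (λ l → summand l 0 j k)
      ≈⟨ trans (∑-suc 0 _) (trans (+-congˡ (∑-zero _)) (+-identityʳ _)) ⟩
    (1# * 1#) * term 0 (0# + α) (0# + β) 0 j k
      ≈⟨ trans (*-congʳ (*-identityˡ 1#)) (*-identityˡ _) ⟩
    term 0 (0# + α) (0# + β) 0 j k
      ≈⟨ ⊛-congˡ (Bz (0# + β)) (xPow/!0-unit (Ay (0# + α))) 0 j k ⟩
    (Ay (0# + α) ⊛ Bz (0# + β)) 0 j k
      ≈⟨ AyBz-at-x0 (0# + α) (0# + β) j k ⟩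
    rising (0# + α) j * rising (0# + β) k
      ≈⟨ *-cong (rising-cong j (+-identityˡ α)) (rising-cong k (+-identityˡ β)) ⟩
    rising α j * rising β k ∎

  rhs-at-x0 : ∀ M N → RHS α β 0 M N ≈ d α M * d β N
  rhs-at-x0 M N = begin
    (expFactor ⊛ inner) 0 M N
      ≈⟨ ⊛≈conv3 expFactor inner 0 M N ⟩
    conv3 expFactor inner 0 M N
      ≈⟨ conv-length0 _ ⟩
    conv M (λ j j' → conv N (λ k k' → expFactor 0 j k * inner 0 j' k'))
      ≈⟨ factor-summands ⟩
    conv M (λ j j' → conv N (λ k k' → ((- β) ^ k * rising β k') * ((- α) ^ j * rising α j')))
      ≈⟨ conv-cong M (λ j j' → trans (conv-cong N (λ k k' → *-comm _ _)) (conv-* N _ _)) ⟩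
    conv M (λ j j' → ((- α) ^ j * rising α j') * d β N)
      ≈⟨ trans (conv-cong M (λ j j' → *-comm _ _)) (conv-* M (d β N) _) ⟩
    d β N * d α M
      ≈⟨ *-comm _ _ ⟩
    d α M * d β N ∎
    where
    import Data.Integer as ℤ
    factor-summands : conv M (λ j j' → conv N (λ k k' → expFactor 0 j k * inner 0 j' k'))
                       ≈ conv M (λ j j' → conv N (λ k k' → ((- β) ^ k * rising β k') * ((- α) ^ j * rising α j')))
    factor-summands = conv-cong M (λ j j' → conv-cong N (λ k k' → trans (*-congˡ (inner-at-x0 j' k'))
      (solve 4 (λ x y p q → con (ℤ.+ 1) :* x :* y :* (p :* q) := y :* q :* (x :* p))
         refl ((- α) ^ j) ((- β) ^ k) (rising α j') (rising β k'))))

module BooleanCounting where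

  open import Data.Nat using (ℕ; zero; suc; _≤_; _<_; _+_; z≤n; s≤s)
  import Data.Nat.Properties as ℕP
  open import Data.Fin as Fin using (Fin; zero; suc)
  import Data.Fin.Properties as FinP
  open import Data.Bool using (Bool; true; false; not; _∧_; if_then_else_; T)
  open import Data.Unit using (tt)
  open import Data.List using (filterᵇ; length; tabulate; applyUpTo)
  open import Data.Product using (∃; _×_; _,_; proj₁; proj₂)
  open import Data.Empty using (⊥-elim)
  open import Relation.Nullary using (yes; no)
  open import Relation.Nullary.Decidable using (⌊_⌋)
  open import Relation.Binary.PropositionalEquality

  ∧-true-elim : ∀ {a b} → (a ∧ b) ≡ true → a ≡ true × b ≡ true
  ∧-true-elim {true} {true} _ = refl , refl

  ∧-intro : ∀ {a b} → a ≡ true → b ≡ true → (a ∧ b) ≡ true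
  ∧-intro refl refl = refl

  not-false : ∀ {a} → not a ≡ true → a ≡ false
  not-false {false} _ = refl

  false≢true : false ≢ true
  false≢true ()

  ≟-sound : ∀ {n} {x y : Fin n} → ⌊ x Fin.≟ y ⌋ ≡ true → x ≡ y
  ≟-sound {x = x} {y} h with x Fin.≟ y
  ... | yes p = p
  ... | no _ = ⊥-elim (false≢true h)

  ≟-refl : ∀ {n} (x : Fin n) → ⌊ x Fin.≟ x ⌋ ≡ true
  ≟-refl x with x Fin.≟ x
  ... | yes _ = refl
  ... | no ¬p = ⊥-elim (¬p refl)

  ≟-false : ∀ {n} {x y : Fin n} → x ≢ y → ⌊ x Fin.≟ y ⌋ ≡ false
  ≟-false {x = x} {y} ne with x Fin.≟ y
  ... | yes p = ⊥-elim (ne p)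
  ... | no _ = refl

  suc-≟ : ∀ {n} (x y : Fin n) → ⌊ Fin.suc x Fin.≟ Fin.suc y ⌋ ≡ ⌊ x Fin.≟ y ⌋
  suc-≟ x y with x Fin.≟ y
  ... | yes refl = refl
  ... | no ne = refl

  bool-ext : ∀ {a b : Bool} → (a ≡ true → b ≡ true) → (b ≡ true → a ≡ true) → a ≡ b
  bool-ext {true} {true} f g = refl
  bool-ext {true} {false} f g = sym (f refl)
  bool-ext {false} {true} f g = g refl
  bool-ext {false} {false} f g = refl

  T→≡ : ∀ {b} → T b → b ≡ true
  T→≡ {true} _ = refl

  ≡→T : ∀ {b} → b ≡ true → T b
  ≡→T refl = tt

  all-tabulate⇒ : ∀ {a} {A : Set a} {n} (q : A → Bool) (h : Fin n → A) → all q (tabulate h) ≡ true → ∀ i → q (h i) ≡ true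
  all-tabulate⇒ {n = suc n} q h e zero = proj₁ (∧-true-elim e)
  all-tabulate⇒ {n = suc n} q h e (suc i) = all-tabulate⇒ q (λ j → h (suc j)) (proj₂ (∧-true-elim e)) i

  ⇒all-tabulate : ∀ {a} {A : Set a} {n} (q : A → Bool) (h : Fin n → A) → (∀ i → q (h i) ≡ true) → all q (tabulate h) ≡ true
  ⇒all-tabulate {n = zero} q h f = refl
  ⇒all-tabulate {n = suc n} q h f = ∧-intro (f zero) (⇒all-tabulate q (λ j → h (suc j)) (λ i → f (suc i)))

  all-applyUpTo⇒ : ∀ {a} {A : Set a} (q : A → Bool) (h : ℕ → A) n → all q (applyUpTo h n) ≡ true → ∀ k → k < n → q (h k) ≡ true
  all-applyUpTo⇒ q h (suc n) e zero _ = proj₁ (∧-true-elim e)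
  all-applyUpTo⇒ q h (suc n) e (suc k) (s≤s lt) = all-applyUpTo⇒ q (λ j → h (suc j)) n (proj₂ (∧-true-elim e)) k lt

  ⇒all-applyUpTo : ∀ {a} {A : Set a} (q : A → Bool) (h : ℕ → A) n → (∀ k → k < n → q (h k) ≡ true) → all q (applyUpTo h n) ≡ true
  ⇒all-applyUpTo q h zero f = refl
  ⇒all-applyUpTo q h (suc n) f = ∧-intro (f zero (s≤s z≤n)) (⇒all-applyUpTo q (λ j → h (suc j)) n (λ k lt → f (suc k) (s≤s lt)))

  all-applyUpTo-false : ∀ {a} {A : Set a} (q : A → Bool) (h : ℕ → A) n → all q (applyUpTo h n) ≡ false → ∃ λ k → k < n × q (h k) ≡ false
  all-applyUpTo-false q h (suc n) e with q (h zero) in eq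
  ... | false = zero , s≤s z≤n , eq
  ... | true with all-applyUpTo-false q (λ j → h (suc j)) n e
  ... | k , lt , e' = suc k , s≤s lt , e'

  count : ∀ {n} → (Fin n → Bool) → ℕ
  count {zero} p = 0
  count {suc n} p = (if p zero then 1 else 0) + count (λ i → p (suc i))

  count-cong : ∀ {n} {p q : Fin n → Bool} → (∀ i → p i ≡ q i) → count p ≡ count q
  count-cong {zero} h = refl
  count-cong {suc n} {p} {q} h = cong₂ _+_ (cong (λ b → if b then 1 else 0) (h zero)) (count-cong (λ i → h (suc i)))

  length-filter-tabulate : ∀ {a} {A : Set a} {n} (p : A → Bool) (h : Fin n → A) → length (filterᵇ p (tabulate h)) ≡ count (λ i → p (h i))
  length-filter-tabulate {n = zero} p h = refl
  length-filter-tabulate {n = suc n} p h with p (h zero)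
  ... | true = cong suc (length-filter-tabulate p (λ i → h (suc i)))
  ... | false = length-filter-tabulate p (λ i → h (suc i))

  count≤ : ∀ {n} (p : Fin n → Bool) → count p ≤ n
  count≤ {zero} p = z≤n
  count≤ {suc n} p with p zero
  ... | true = s≤s (count≤ (λ i → p (suc i)))
  ... | false = ℕP.m≤n⇒m≤1+n (count≤ (λ i → p (suc i)))

  count-none : ∀ {n} (p : Fin n → Bool) → (∀ i → p i ≡ false) → count p ≡ 0
  count-none {zero} p h = refl
  count-none {suc n} p h rewrite h zero = count-none (λ i → p (suc i)) (λ i → h (suc i))

  count-split : ∀ {n} (p q : Fin n → Bool) → count p ≡ count (λ i → p i ∧ q i) + count (λ i → p i ∧ not (q i))
  count-split {zero} p q = refl
  count-split {suc n} p q with p zero | q zero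
  ... | false | _ = count-split (λ i → p (suc i)) (λ i → q (suc i))
  ... | true | true = cong suc (count-split (λ i → p (suc i)) (λ i → q (suc i)))
  ... | true | false = trans (cong suc (count-split (λ i → p (suc i)) (λ i → q (suc i)))) (sym (ℕP.+-suc _ _))

  count-unique : ∀ {n} (p : Fin n → Bool) (m : Fin n) → p m ≡ true → (∀ i → p i ≡ true → i ≡ m) → count p ≡ 1
  count-unique {suc n} p zero pm h rewrite pm = cong suc (count-none (λ i → p (suc i)) f)
    where
    f : ∀ i → p (suc i) ≡ false
    f i with p (suc i) in eq
    ... | false = refl
    ... | true with h (suc i) eq
    ... | ()
  count-unique {suc n} p (suc m) pm h with p zero in eq
  ... | true with h zero eq
  ... | ()
  count-unique {suc n} p (suc m) pm h | false = count-unique (λ i → p (suc i)) m pm (λ i e → FinP.suc-injective (h (suc i) e))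


module Orbits where

  open import Data.Bool.Properties using (not-injective)
  open import Data.Nat as ℕ using (zero; suc; _≤_; _<_; _≤ᵇ_; _+_; _∸_; _*_; s≤s)
  import Data.Nat.Properties as ℕP
  open import Data.Fin as Fin using (Fin; zero; suc; toℕ)
  import Data.Fin.Properties as FinP
  open import Data.Bool using (Bool; true; false; not; _∨_)
  open import Data.List using (upTo)
  open import Data.Product using (∃; _×_; _,_)
  open import Data.Empty using (⊥-elim)
  open import Relation.Nullary using (yes; no)
  open import Relation.Nullary.Decidable using (⌊_⌋)
  open import Relation.Binary.PropositionalEquality
  open BooleanCounting

  iter-+ : ∀ {n} (f : Fin n → Fin n) a b i → iter f (a + b) i ≡ iter f a (iter f b i)
  iter-+ f zero b i = refl
  iter-+ f (suc a) b i = cong f (iter-+ f a b i)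

  -- pigeonhole: among the first n+1 iterates of i two coincide
  iter-repeats : ∀ {n} (f : Fin n → Fin n) i → ∃ λ p → ∃ λ q → p < q × q ≤ n × iter f p i ≡ iter f q i
  iter-repeats {n} f i with FinP.pigeonhole (ℕP.n<1+n n) (λ (t : Fin (suc n)) → iter f (toℕ t) i)
  ... | t1 , t2 , lt , eq = toℕ t1 , toℕ t2 , lt , ℕP.≤-pred (FinP.toℕ<n t2) , eq

  iter-below-n : ∀ {n} (f : Fin n → Fin n) i K → ∃ λ K' → K' < n × iter f K i ≡ iter f K' i
  iter-below-n {n} f i K with iter-repeats f i
  ... | p , q , p<q , q≤n , eq = go (suc K) K (ℕP.n<1+n K)
    where
    step-back : ∀ K → q ≤ K → iter f K i ≡ iter f (K ∸ q + p) i
    step-back K q≤K = begin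
      iter f K i                  ≡⟨ cong (λ x → iter f x i) (sym (ℕP.m∸n+n≡m q≤K)) ⟩
      iter f (K ∸ q + q) i        ≡⟨ iter-+ f (K ∸ q) q i ⟩
      iter f (K ∸ q) (iter f q i) ≡⟨ cong (iter f (K ∸ q)) (sym eq) ⟩
      iter f (K ∸ q) (iter f p i) ≡⟨ sym (iter-+ f (K ∸ q) p i) ⟩
      iter f (K ∸ q + p) i        ∎
      where open ≡-Reasoning
    step-back-< : ∀ K → q ≤ K → K ∸ q + p < K
    step-back-< K q≤K = ℕP.<-≤-trans (ℕP.+-monoʳ-< (K ∸ q) p<q) (ℕP.≤-reflexive (ℕP.m∸n+n≡m q≤K))
    go : ∀ fuel K → K < fuel → ∃ λ K' → K' < n × iter f K i ≡ iter f K' i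
    go (suc fuel) K (s≤s K≤fuel) with K ℕ.<? q
    ... | yes K<q = K , ℕP.<-≤-trans K<q q≤n , refl
    ... | no K≮q with go fuel (K ∸ q + p) (ℕP.<-≤-trans (step-back-< K (ℕP.≮⇒≥ K≮q)) K≤fuel)
    ... | K' , K'<n , e = K' , K'<n , trans (step-back K (ℕP.≮⇒≥ K≮q)) e

  IsCycleMin : ∀ {n} → (Fin n → Fin n) → Fin n → Set
  IsCycleMin f i = ∀ K → toℕ i ≤ toℕ (iter f K i)

  cycleMinᵇ-sound : ∀ {n} (f : Fin n → Fin n) i → isCycleMinᵇ f i ≡ true → IsCycleMin f i
  cycleMinᵇ-sound {n} f i e K with iter-below-n f i K
  ... | K' , lt , eq rewrite eq = ℕP.≤ᵇ⇒≤ (toℕ i) (toℕ (iter f K' i)) (≡→T (all-applyUpTo⇒ (λ k → toℕ i ≤ᵇ toℕ (iter f k i)) (λ k → k) n e K' lt))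

  cycleMinᵇ-complete : ∀ {n} (f : Fin n → Fin n) i → IsCycleMin f i → isCycleMinᵇ f i ≡ true
  cycleMinᵇ-complete {n} f i h = ⇒all-applyUpTo (λ k → toℕ i ≤ᵇ toℕ (iter f k i)) (λ k → k) n (λ k _ → T→≡ (ℕP.≤⇒≤ᵇ (h k)))

  not-cycleMin : ∀ {n} (f : Fin n → Fin n) i → isCycleMinᵇ f i ≡ false → ∃ λ K → toℕ (iter f K i) < toℕ i
  not-cycleMin {n} f i e with all-applyUpTo-false (λ k → toℕ i ≤ᵇ toℕ (iter f k i)) (λ k → k) n e
  ... | k , _ , e' = k , ℕP.≰⇒> (λ le → false≢true (trans (sym e') (T→≡ (ℕP.≤⇒≤ᵇ le))))

  IsInjective : ∀ {n} → (Fin n → Fin n) → Set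
  IsInjective f = ∀ i j → f i ≡ f j → i ≡ j

  injectiveᵇ-sound : ∀ {n} (f : Fin n → Fin n) → isInjectiveᵇ f ≡ true → IsInjective f
  injectiveᵇ-sound {n} f e i j eq = ≟-sound (collision (all-tabulate⇒ _ (λ k → k) (all-tabulate⇒ _ (λ k → k) e i) j))
    where
    collision : (not ⌊ f i Fin.≟ f j ⌋ ∨ ⌊ i Fin.≟ j ⌋) ≡ true → ⌊ i Fin.≟ j ⌋ ≡ true
    collision h rewrite eq | ≟-refl (f j) = h

  injectiveᵇ-complete : ∀ {n} (f : Fin n → Fin n) → IsInjective f → isInjectiveᵇ f ≡ true
  injectiveᵇ-complete {n} f inj = ⇒all-tabulate _ (λ k → k) (λ i → ⇒all-tabulate _ (λ k → k) (λ j → no-collision i j))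
    where
    no-collision : ∀ i j → (not ⌊ f i Fin.≟ f j ⌋ ∨ ⌊ i Fin.≟ j ⌋) ≡ true
    no-collision i j with f i Fin.≟ f j
    ... | no _ = refl
    ... | yes e rewrite inj i j e | ≟-refl j = refl

  collision⇒¬injectiveᵇ : ∀ {n} (f : Fin n → Fin n) i j → i ≢ j → f i ≡ f j → isInjectiveᵇ f ≡ false
  collision⇒¬injectiveᵇ f i j ne eq with isInjectiveᵇ f in e
  ... | false = refl
  ... | true = ⊥-elim (ne (injectiveᵇ-sound f e i j eq))

  injectiveᵇ-≡ : ∀ {n m} (f : Fin n → Fin n) (g : Fin m → Fin m) → (IsInjective f → IsInjective g) → (IsInjective g → IsInjective f) → isInjectiveᵇ f ≡ isInjectiveᵇ g
  injectiveᵇ-≡ f g a b = bool-ext (λ e → injectiveᵇ-complete g (a (injectiveᵇ-sound f e))) (λ e → injectiveᵇ-complete f (b (injectiveᵇ-sound g e)))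

  iter-injective : ∀ {n} (f : Fin n → Fin n) → IsInjective f → ∀ k → IsInjective (iter f k)
  iter-injective f inj zero i j e = e
  iter-injective f inj (suc k) i j e = iter-injective f inj k i j (inj _ _ e)

  period : ∀ {n} (g : Fin n → Fin n) → IsInjective g → ∀ i → ∃ λ p → 0 < p × iter g p i ≡ i
  period g inj i with iter-repeats g i
  ... | p , q , p<q , _ , eq = q ∸ p , ℕP.m<n⇒0<n∸m p<q , sym (iter-injective g inj p _ _ e)
    where
    e : iter g p i ≡ iter g p (iter g (q ∸ p) i)
    e = trans eq (trans (cong (λ x → iter g x i) (sym (ℕP.m+[n∸m]≡n (ℕP.<⇒≤ p<q)))) (iter-+ g p (q ∸ p) i))

  iter-period-multiple : ∀ {n} (g : Fin n → Fin n) p i → iter g p i ≡ i → ∀ t → iter g (t * p) i ≡ i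
  iter-period-multiple g p i e zero = refl
  iter-period-multiple g p i e (suc t) = trans (iter-+ g p (t * p) i) (trans (cong (iter g p) (iter-period-multiple g p i e t)) e)

  orbit-symmetric : ∀ {n} (g : Fin n → Fin n) → IsInjective g → ∀ i b K → iter g K i ≡ b → ∃ λ M → iter g M b ≡ i
  orbit-symmetric g inj i b K e with period g inj i
  ... | p , 0<p , ep = K * p ∸ K , (begin
      iter g (K * p ∸ K) b ≡⟨ cong (iter g (K * p ∸ K)) (sym e) ⟩
      iter g (K * p ∸ K) (iter g K i) ≡⟨ sym (iter-+ g (K * p ∸ K) K i) ⟩
      iter g (K * p ∸ K + K) i ≡⟨ cong (λ x → iter g x i) (ℕP.m∸n+n≡m (ℕP.m≤m*n K p)) ⟩
      iter g (K * p) i ≡⟨ iter-period-multiple g p i ep K ⟩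
      i ∎)
    where
    open ≡-Reasoning
    instance _ = ℕ.>-nonZero 0<p

  reachesᵇ : ∀ {n} → (Fin n → Fin n) → Fin n → Fin n → Bool
  reachesᵇ {n} g i b = not (all (λ k → not ⌊ iter g k i Fin.≟ b ⌋) (upTo n))

  reachesᵇ-sound : ∀ {n} (g : Fin n → Fin n) i b → reachesᵇ g i b ≡ true → ∃ λ K → iter g K i ≡ b
  reachesᵇ-sound {n} g i b e with all-applyUpTo-false (λ k → not ⌊ iter g k i Fin.≟ b ⌋) (λ k → k) n (not-false e)
  ... | k , _ , e' = k , ≟-sound (not-injective e')

  reachesᵇ-complete : ∀ {n} (g : Fin n → Fin n) i b → (∃ λ K → iter g K i ≡ b) → reachesᵇ g i b ≡ true
  reachesᵇ-complete {n} g i b (K , e) with iter-below-n g i K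
  ... | K' , lt , eq with all (λ k → not ⌊ iter g k i Fin.≟ b ⌋) (upTo n) in ea
  ... | false = refl
  ... | true = ⊥-elim (false≢true (trans (sym (cong not (≟-refl b))) (subst (λ x → not ⌊ x Fin.≟ b ⌋ ≡ true) (trans (sym eq) e) (all-applyUpTo⇒ _ (λ k → k) n ea K' lt))))


module CycleStatistics where

  open import Data.Bool.Properties using (∧-identityʳ)
  open import Data.Nat using (ℕ; zero; suc; _≤_; _≡ᵇ_)
  open import Data.Fin as Fin using (Fin; zero; suc; toℕ)
  open import Data.Bool using (Bool; true; false; not; _∧_)
  open import Data.List using (tabulate)
  open import Relation.Nullary.Decidable using (⌊_⌋)
  open import Relation.Binary.PropositionalEquality
  open BooleanCounting
  open Orbits

  fixedCount : ∀ {n} → (Fin n → Fin n) → ℕ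
  fixedCount f = count (λ i → ⌊ f i Fin.≟ i ⌋)

  cycleCount : ∀ {n} → (Fin n → Fin n) → ℕ
  cycleCount f = count (λ i → isCycleMinᵇ f i ∧ not ⌊ f i Fin.≟ i ⌋)

  cyc≡count : ∀ {n} (f : Fin n → Fin n) → cyc f ≡ count (isCycleMinᵇ f)
  cyc≡count f = length-filter-tabulate (isCycleMinᵇ f) (λ k → k)

  all-not-tabulate : ∀ {a} {A : Set a} {n} (p : A → Bool) (h : Fin n → A) → all (λ x → not (p x)) (tabulate h) ≡ (count (λ i → p (h i)) ≡ᵇ 0)
  all-not-tabulate {n = zero} p h = refl
  all-not-tabulate {n = suc n} p h with p (h zero)
  ... | true = refl
  ... | false = all-not-tabulate p (λ i → h (suc i))

  fixedPointFreeᵇ≡ : ∀ {n} (f : Fin n → Fin n) → isFixedPointFreeᵇ f ≡ (fixedCount f ≡ᵇ 0)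
  fixedPointFreeᵇ≡ f = all-not-tabulate (λ i → ⌊ f i Fin.≟ i ⌋) (λ k → k)

  fixedPointFreeᵇ-sound : ∀ {n} (f : Fin n → Fin n) → isFixedPointFreeᵇ f ≡ true → ∀ i → ⌊ f i Fin.≟ i ⌋ ≡ false
  fixedPointFreeᵇ-sound f e i = not-false (all-tabulate⇒ (λ i → not ⌊ f i Fin.≟ i ⌋) (λ k → k) e i)

  cyc≡cycleCount : ∀ {n} (f : Fin n → Fin n) → isFixedPointFreeᵇ f ≡ true → cyc f ≡ cycleCount f
  cyc≡cycleCount f e = trans (cyc≡count f) (count-cong λ i → sym (not-fixed (fixedPointFreeᵇ-sound f e i)))
    where
    not-fixed : ∀ {a b} → b ≡ false → (a ∧ not b) ≡ a
    not-fixed {a} refl = ∧-identityʳ a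

  iter-ext : ∀ {n} {f g : Fin n → Fin n} → (∀ x → f x ≡ g x) → ∀ K i → iter f K i ≡ iter g K i
  iter-ext h zero i = refl
  iter-ext {f = f} {g} h (suc K) i = trans (cong f (iter-ext h K i)) (h _)

  cycleMinᵇ-ext : ∀ {n} {f g : Fin n → Fin n} → (∀ x → f x ≡ g x) → ∀ i → isCycleMinᵇ f i ≡ isCycleMinᵇ g i
  cycleMinᵇ-ext {f = f} {g} h i = bool-ext (λ e → cycleMinᵇ-complete g i (λ K → subst (λ x → toℕ i ≤ toℕ x) (iter-ext h K i) (cycleMinᵇ-sound f i e K)))
                                    (λ e → cycleMinᵇ-complete f i (λ K → subst (λ x → toℕ i ≤ toℕ x) (sym (iter-ext h K i)) (cycleMinᵇ-sound g i e K)))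

  injectiveᵇ-ext : ∀ {n} {f g : Fin n → Fin n} → (∀ x → f x ≡ g x) → isInjectiveᵇ f ≡ isInjectiveᵇ g
  injectiveᵇ-ext {f = f} {g} h = injectiveᵇ-≡ f g (λ inj i j e → inj i j (trans (h i) (trans e (sym (h j))))) (λ inj i j e → inj i j (trans (sym (h i)) (trans e (h j))))

  fixedCount-ext : ∀ {n} {f g : Fin n → Fin n} → (∀ x → f x ≡ g x) → fixedCount f ≡ fixedCount g
  fixedCount-ext h = count-cong (λ i → cong (λ y → ⌊ y Fin.≟ i ⌋) (h i))

  cycleCount-ext : ∀ {n} {f g : Fin n → Fin n} → (∀ x → f x ≡ g x) → cycleCount f ≡ cycleCount g
  cycleCount-ext h = count-cong (λ i → cong₂ (λ a y → a ∧ not ⌊ y Fin.≟ i ⌋) (cycleMinᵇ-ext h i) (h i))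


-- The two ways of obtaining a permutation of Fin (n+1) from one of Fin n:
-- addFixed g adjoins 0 as a fixed point; insertAfter g b inserts 0 into the
-- cycle of b, right after b.
module Insertion where

  open import Data.Bool.Properties using (∧-zeroʳ; ∧-identityʳ)
  open import Data.Nat as ℕ using (zero; suc; _≤_; _<_; _+_; z≤n; s≤s)
  import Data.Nat.Properties as ℕP
  open import Data.Fin as Fin using (Fin; zero; suc; toℕ)
  import Data.Fin.Properties as FinP
  open import Data.Bool using (Bool; true; false; not; _∧_; if_then_else_)
  open import Data.Product using (∃; _×_; _,_; proj₁; proj₂)
  open import Data.Sum using (_⊎_; inj₁; inj₂)
  open import Data.Empty using (⊥-elim)
  open import Relation.Nullary using (yes; no)
  open import Relation.Nullary.Decidable using (⌊_⌋)
  open import Relation.Binary.PropositionalEquality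
  open BooleanCounting
  open Orbits
  open CycleStatistics

  addFixed : ∀ {n} → (Fin n → Fin n) → Fin (suc n) → Fin (suc n)
  addFixed g zero = zero
  addFixed g (suc i) = suc (g i)

  insertAfter : ∀ {n} → (Fin n → Fin n) → Fin n → Fin (suc n) → Fin (suc n)
  insertAfter g b zero = suc (g b)
  insertAfter g b (suc i) = if ⌊ i Fin.≟ b ⌋ then zero else suc (g i)

  insertAfter-b : ∀ {n} (g : Fin n → Fin n) b → insertAfter g b (suc b) ≡ zero
  insertAfter-b g b with b Fin.≟ b
  ... | yes _ = refl
  ... | no ne = ⊥-elim (ne refl)

  insertAfter-other : ∀ {n} (g : Fin n → Fin n) b i → i ≢ b → insertAfter g b (suc i) ≡ suc (g i)
  insertAfter-other g b i ne with i Fin.≟ b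
  ... | yes e = ⊥-elim (ne e)
  ... | no _ = refl

  injectiveᵇ-addFixed : ∀ {n} (g : Fin n → Fin n) → isInjectiveᵇ (addFixed g) ≡ isInjectiveᵇ g
  injectiveᵇ-addFixed g = injectiveᵇ-≡ (addFixed g) g (λ inj i j e → FinP.suc-injective (inj (suc i) (suc j) (cong suc e))) back
    where
    back : IsInjective g → IsInjective (addFixed g)
    back inj zero zero e = refl
    back inj zero (suc j) ()
    back inj (suc i) zero ()
    back inj (suc i) (suc j) e = cong suc (inj i j (FinP.suc-injective e))

  fixedCount-addFixed : ∀ {n} (g : Fin n → Fin n) → fixedCount (addFixed g) ≡ suc (fixedCount g)
  fixedCount-addFixed g = cong suc (count-cong (λ i → suc-≟ (g i) i))

  iter-addFixed : ∀ {n} (g : Fin n → Fin n) K i → iter (addFixed g) K (suc i) ≡ suc (iter g K i)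
  iter-addFixed g zero i = refl
  iter-addFixed g (suc K) i = cong (addFixed g) (iter-addFixed g K i)

  cycleMinᵇ-addFixed : ∀ {n} (g : Fin n → Fin n) i → isCycleMinᵇ (addFixed g) (suc i) ≡ isCycleMinᵇ g i
  cycleMinᵇ-addFixed g i = bool-ext (λ e → cycleMinᵇ-complete g i (λ K → ℕP.≤-pred (subst (λ x → suc (toℕ i) ≤ toℕ x) (iter-addFixed g K i) (cycleMinᵇ-sound (addFixed g) (suc i) e K))))
                     (λ e → cycleMinᵇ-complete (addFixed g) (suc i) (λ K → subst (λ x → suc (toℕ i) ≤ toℕ x) (sym (iter-addFixed g K i)) (s≤s (cycleMinᵇ-sound g i e K))))

  cycleCount-addFixed : ∀ {n} (g : Fin n → Fin n) → cycleCount (addFixed g) ≡ cycleCount g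
  cycleCount-addFixed g = trans (cong (λ b → (if b then 1 else 0) + count (λ z → isCycleMinᵇ (addFixed g) (suc z) ∧ not ⌊ suc (g z) Fin.≟ suc z ⌋)) (∧-zeroʳ (isCycleMinᵇ (addFixed g) zero)))
                    (count-cong (λ i → cong₂ (λ a c → a ∧ not c) (cycleMinᵇ-addFixed g i) (suc-≟ (g i) i)))


  injectiveᵇ-insertAfter : ∀ {n} (g : Fin n → Fin n) b → isInjectiveᵇ (insertAfter g b) ≡ isInjectiveᵇ g
  injectiveᵇ-insertAfter g b = injectiveᵇ-≡ (insertAfter g b) g fwd back
    where
    fwd : IsInjective (insertAfter g b) → IsInjective g
    fwd inj i j e with i Fin.≟ b | j Fin.≟ b
    ... | yes refl | yes refl = refl
    ... | yes refl | no nj with inj zero (suc j) (trans (cong suc e) (sym (insertAfter-other g b j nj)))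
    ... | ()
    fwd inj i j e | no ni | yes refl with inj zero (suc i) (trans (cong suc (sym e)) (sym (insertAfter-other g b i ni)))
    ... | ()
    fwd inj i j e | no ni | no nj = FinP.suc-injective (inj (suc i) (suc j) (trans (insertAfter-other g b i ni) (trans (cong suc e) (sym (insertAfter-other g b j nj)))))
    back : IsInjective g → IsInjective (insertAfter g b)
    back inj zero zero e = refl
    back inj zero (suc j) e with j Fin.≟ b
    ... | yes _ = ⊥-elim (FinP.0≢1+n (sym e))
    ... | no nj = ⊥-elim (nj (sym (inj b j (FinP.suc-injective e))))
    back inj (suc i) zero e with i Fin.≟ b
    ... | yes _ = ⊥-elim (FinP.0≢1+n e)
    ... | no ni = ⊥-elim (ni (inj i b (FinP.suc-injective e)))
    back inj (suc i) (suc j) e with i Fin.≟ b | j Fin.≟ b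
    ... | yes refl | yes refl = refl
    ... | yes refl | no _ = ⊥-elim (FinP.0≢1+n e)
    ... | no _ | yes refl = ⊥-elim (FinP.0≢1+n (sym e))
    ... | no _ | no _ = cong suc (inj i j (FinP.suc-injective e))

  fixed-insertAfter : ∀ {n} (g : Fin n → Fin n) b i → ⌊ insertAfter g b (suc i) Fin.≟ suc i ⌋ ≡ (⌊ g i Fin.≟ i ⌋ ∧ not ⌊ i Fin.≟ b ⌋)
  fixed-insertAfter g b i with i Fin.≟ b
  ... | yes _ = sym (∧-zeroʳ _)
  ... | no _  = trans (suc-≟ (g i) i) (sym (∧-identityʳ _))

  count-at : ∀ {n} (p : Fin n → Bool) b → count (λ i → p i ∧ ⌊ i Fin.≟ b ⌋) ≡ (if p b then 1 else 0)
  count-at p b with p b in eq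
  ... | true = count-unique _ b (trans (cong (_∧ ⌊ b Fin.≟ b ⌋) eq) (≟-refl b)) (λ i e → ≟-sound (proj₂ (∧-true-elim e)))
  ... | false = count-none _ not-b
    where
    not-b : ∀ i → (p i ∧ ⌊ i Fin.≟ b ⌋) ≡ false
    not-b i with i Fin.≟ b
    ... | yes refl = cong (_∧ true) eq
    ... | no _     = ∧-zeroʳ (p i)

  fixedCount-insertAfter : ∀ {n} (g : Fin n → Fin n) b → fixedCount g ≡ (if ⌊ g b Fin.≟ b ⌋ then 1 else 0) + fixedCount (insertAfter g b)
  fixedCount-insertAfter g b = trans (count-split (λ i → ⌊ g i Fin.≟ i ⌋) (λ i → ⌊ i Fin.≟ b ⌋))
    (cong₂ _+_ (count-at (λ i → ⌊ g i Fin.≟ i ⌋) b) (count-cong (λ i → sym (fixed-insertAfter g b i))))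

  iter-fixed : ∀ {n} (g : Fin n → Fin n) m → g m ≡ m → ∀ K → iter g K m ≡ m
  iter-fixed g m e zero = refl
  iter-fixed g m e (suc K) = trans (cong g (iter-fixed g m e K)) e

  iter-compose : ∀ {n} (g : Fin n → Fin n) {x y z} K M → iter g K x ≡ y → iter g M y ≡ z → iter g (M + K) x ≡ z
  iter-compose g {x} K M e1 e2 = trans (iter-+ g M K x) (trans (cong (iter g M) e1) e2)

  iter-insertAfter-avoiding : ∀ {n} (g : Fin n → Fin n) b i → (∀ K → iter g K i ≢ b) → ∀ K → iter (insertAfter g b) K (suc i) ≡ suc (iter g K i)
  iter-insertAfter-avoiding g b i h zero = refl
  iter-insertAfter-avoiding g b i h (suc K) = trans (cong (insertAfter g b) (iter-insertAfter-avoiding g b i h K)) (insertAfter-other g b (iter g K i) (h K))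

  iter-insertAfter-until : ∀ {n} (g : Fin n → Fin n) b i K → (iter (insertAfter g b) K (suc i) ≡ suc (iter g K i)) ⊎ (∃ λ K' → iter (insertAfter g b) K' (suc i) ≡ zero)
  iter-insertAfter-until g b i zero = inj₁ refl
  iter-insertAfter-until g b i (suc K) with iter-insertAfter-until g b i K
  ... | inj₂ r = inj₂ r
  ... | inj₁ e with iter g K i Fin.≟ b
  ... | yes eb = inj₂ (suc K , trans (cong (insertAfter g b) (trans e (cong suc eb))) (insertAfter-b g b))
  ... | no nb = inj₁ (trans (cong (insertAfter g b) e) (insertAfter-other g b (iter g K i) nb))

  iter-insertAfter-reaches : ∀ {n} (g : Fin n → Fin n) b i K → iter g K i ≡ b → ∃ λ K' → iter (insertAfter g b) K' (suc i) ≡ zero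
  iter-insertAfter-reaches g b i K eb with iter-insertAfter-until g b i K
  ... | inj₂ r = r
  ... | inj₁ e = suc K , trans (cong (insertAfter g b) (trans e (cong suc eb))) (insertAfter-b g b)

  cycleLeaderᵇ : ∀ {n} → (Fin n → Fin n) → Fin n → Bool
  cycleLeaderᵇ g i = isCycleMinᵇ g i ∧ not ⌊ g i Fin.≟ i ⌋

  -- a non-trivial cycle of g not containing b remains one under insertAfter g b;
  -- the cycle through b now contains 0 and is led by 0
  cycleLeader-insertAfter : ∀ {n} (g : Fin n → Fin n) b i →
    (isCycleMinᵇ (insertAfter g b) (suc i) ∧ not ⌊ insertAfter g b (suc i) Fin.≟ suc i ⌋) ≡ (cycleLeaderᵇ g i ∧ not (reachesᵇ g i b))
  cycleLeader-insertAfter g b i with reachesᵇ g i b in eo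
  ... | true = trans (cong (λ x → x ∧ not ⌊ insertAfter g b (suc i) Fin.≟ suc i ⌋) not-min) (sym (∧-zeroʳ (cycleLeaderᵇ g i)))
    where
    not-min : isCycleMinᵇ (insertAfter g b) (suc i) ≡ false
    not-min with isCycleMinᵇ (insertAfter g b) (suc i) in ec
    ... | false = refl
    ... | true with reachesᵇ-sound g i b eo
    ... | K , eK with iter-insertAfter-reaches g b i K eK
    ... | K' , z with subst (λ x → suc (toℕ i) ≤ toℕ x) z (cycleMinᵇ-sound (insertAfter g b) (suc i) ec K')
    ... | ()
  ... | false = trans (cong₂ (λ x y → x ∧ not y) min-same fixed-same) (sym (∧-identityʳ (cycleLeaderᵇ g i)))
    where
    never-b : ∀ K → iter g K i ≢ b
    never-b K e = false≢true (trans (sym eo) (reachesᵇ-complete g i b (K , e)))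
    same-orbit : ∀ K → iter (insertAfter g b) K (suc i) ≡ suc (iter g K i)
    same-orbit = iter-insertAfter-avoiding g b i never-b
    min-same : isCycleMinᵇ (insertAfter g b) (suc i) ≡ isCycleMinᵇ g i
    min-same = bool-ext (λ e → cycleMinᵇ-complete g i (λ K → ℕP.≤-pred (subst (λ x → suc (toℕ i) ≤ toℕ x) (same-orbit K) (cycleMinᵇ-sound (insertAfter g b) (suc i) e K))))
                  (λ e → cycleMinᵇ-complete (insertAfter g b) (suc i) (λ K → subst (λ x → suc (toℕ i) ≤ toℕ x) (sym (same-orbit K)) (s≤s (cycleMinᵇ-sound g i e K))))
    fixed-same : ⌊ insertAfter g b (suc i) Fin.≟ suc i ⌋ ≡ ⌊ g i Fin.≟ i ⌋
    fixed-same = trans (cong (λ x → ⌊ x Fin.≟ suc i ⌋) (insertAfter-other g b i (never-b 0))) (suc-≟ (g i) i)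

  -- every orbit contains a cycle minimum (descend along smaller iterates)
  cycleMin-exists : ∀ {n} (g : Fin n → Fin n) b → ∀ fuel c → toℕ c < fuel → (∃ λ K → iter g K b ≡ c) →
    ∃ λ m → isCycleMinᵇ g m ≡ true × (∃ λ K → iter g K b ≡ m)
  cycleMin-exists g b (suc fuel) c (s≤s lt) r with isCycleMinᵇ g c in ec
  ... | true = c , ec , r
  ... | false with not-cycleMin g c ec
  ... | K' , lt' = cycleMin-exists g b fuel (iter g K' c) (ℕP.<-≤-trans lt' lt) (K' ℕ.+ proj₁ r , iter-compose g (proj₁ r) K' (proj₂ r) refl)

  reaches-fixed : ∀ {n} (g : Fin n → Fin n) → IsInjective g → ∀ {i b} → g b ≡ b → (∃ λ K → iter g K i ≡ b) → i ≡ b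
  reaches-fixed g inj {i} {b} gb (K , eK) with orbit-symmetric g inj i b K eK
  ... | M , eM = trans (sym eM) (iter-fixed g b gb M)

  cycleMin-unique : ∀ {n} (g : Fin n → Fin n) → IsInjective g → ∀ {i m b} →
    isCycleMinᵇ g i ≡ true → isCycleMinᵇ g m ≡ true → (∃ λ K → iter g K i ≡ b) → (∃ λ K → iter g K m ≡ b) → i ≡ m
  cycleMin-unique g inj {i} {m} {b} ci cm (K , eK) (Km , eKm) with orbit-symmetric g inj m b Km eKm | orbit-symmetric g inj i b K eK
  ... | Mb , eMb | M , eM = FinP.toℕ-injective (ℕP.≤-antisym i≤m m≤i)
    where
    i≤m : toℕ i ≤ toℕ m
    i≤m = subst (λ x → toℕ i ≤ toℕ x) (iter-compose g K Mb eK eMb) (cycleMinᵇ-sound g i ci (Mb ℕ.+ K))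
    m≤i : toℕ m ≤ toℕ i
    m≤i = subst (λ x → toℕ m ≤ toℕ x) (iter-compose g Km M eKm eM) (cycleMinᵇ-sound g m cm (M ℕ.+ Km))

  count-leaders-reaching : ∀ {n} (g : Fin n → Fin n) → IsInjective g → ∀ b →
    count (λ i → cycleLeaderᵇ g i ∧ reachesᵇ g i b) ≡ (if ⌊ g b Fin.≟ b ⌋ then 0 else 1)
  count-leaders-reaching g inj b with g b Fin.≟ b
  ... | yes gb = count-none _ no-leader
    where
    no-leader : ∀ i → (cycleLeaderᵇ g i ∧ reachesᵇ g i b) ≡ false
    no-leader i with cycleLeaderᵇ g i ∧ reachesᵇ g i b in e
    ... | false = refl
    ... | true with ∧-true-elim e
    ... | ep , eo = ⊥-elim (false≢true (trans (sym (trans (cong (λ x → not ⌊ x Fin.≟ i ⌋) gi) (cong not (≟-refl i))))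
                                              (proj₂ (∧-true-elim ep))))
      where
      ib : i ≡ b
      ib = reaches-fixed g inj gb (reachesᵇ-sound g i b eo)
      gi : g i ≡ i
      gi = trans (cong g ib) (trans gb (sym ib))
  ... | no ngb with cycleMin-exists g b (suc (toℕ b)) b (ℕP.n<1+n (toℕ b)) (0 , refl)
  ... | m , cmm , (Km , eKm) with orbit-symmetric g inj b m Km eKm
  ... | Mb , eMb = count-unique _ m leader unique
    where
    gm : g m ≢ m
    gm e = ngb (trans (cong g bm) (trans e (sym bm)))
      where
      bm : b ≡ m
      bm = trans (sym eMb) (iter-fixed g m e Mb)
    moved : not ⌊ g m Fin.≟ m ⌋ ≡ true
    moved rewrite ≟-false gm = refl
    leader : (cycleLeaderᵇ g m ∧ reachesᵇ g m b) ≡ true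
    leader = ∧-intro (∧-intro cmm moved) (reachesᵇ-complete g m b (Mb , eMb))
    unique : ∀ i → (cycleLeaderᵇ g i ∧ reachesᵇ g i b) ≡ true → i ≡ m
    unique i e with ∧-true-elim e
    ... | ep , eo = cycleMin-unique g inj (proj₁ (∧-true-elim ep)) cmm (reachesᵇ-sound g i b eo) (Mb , eMb)

  -- inserting 0 after b adds a cycle iff b was fixed (the new cycle (b 0))
  cycleCount-insertAfter : ∀ {n} (g : Fin n → Fin n) → IsInjective g → ∀ b → cycleCount (insertAfter g b) ≡ cycleCount g + (if ⌊ g b Fin.≟ b ⌋ then 1 else 0)
  cycleCount-insertAfter g inj b = begin
    cycleCount (insertAfter g b) ≡⟨ cong (λ x → (if x then 1 else 0) + count (λ i → isCycleMinᵇ (insertAfter g b) (suc i) ∧ not ⌊ insertAfter g b (suc i) Fin.≟ suc i ⌋)) zero-leads ⟩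
    suc (count (λ i → isCycleMinᵇ (insertAfter g b) (suc i) ∧ not ⌊ insertAfter g b (suc i) Fin.≟ suc i ⌋)) ≡⟨ cong suc (count-cong (cycleLeader-insertAfter g b)) ⟩
    suc (count (λ i → cycleLeaderᵇ g i ∧ not (reachesᵇ g i b))) ≡⟨ rearrange (count (λ i → cycleLeaderᵇ g i ∧ reachesᵇ g i b)) (count-leaders-reaching g inj b) ⟩
    count (λ i → cycleLeaderᵇ g i ∧ reachesᵇ g i b) + count (λ i → cycleLeaderᵇ g i ∧ not (reachesᵇ g i b)) + (if ⌊ g b Fin.≟ b ⌋ then 1 else 0)
      ≡⟨ cong (_+ (if ⌊ g b Fin.≟ b ⌋ then 1 else 0)) (sym (count-split (cycleLeaderᵇ g) (λ i → reachesᵇ g i b))) ⟩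
    cycleCount g + (if ⌊ g b Fin.≟ b ⌋ then 1 else 0) ∎
    where
    open ≡-Reasoning
    zero-leads : (isCycleMinᵇ (insertAfter g b) zero ∧ not ⌊ insertAfter g b zero Fin.≟ zero ⌋) ≡ true
    zero-leads = ∧-intro (cycleMinᵇ-complete (insertAfter g b) zero (λ K → z≤n)) refl
    Y : ℕ
    Y = count (λ i → cycleLeaderᵇ g i ∧ not (reachesᵇ g i b))
    rearrange : ∀ X → X ≡ (if ⌊ g b Fin.≟ b ⌋ then 0 else 1) → suc Y ≡ X + Y + (if ⌊ g b Fin.≟ b ⌋ then 1 else 0)
    rearrange X eX with ⌊ g b Fin.≟ b ⌋
    ... | true rewrite eX = ℕP.+-comm 1 Y
    ... | false rewrite eX = sym (ℕP.+-identityʳ (suc Y))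


module Tables where

  open import Data.Nat using (zero; suc)
  import Data.Nat.Properties as ℕP
  open import Data.Fin as Fin using (Fin; zero; suc)
  import Data.Fin.Properties as FinP
  open import Data.Bool using (false; if_then_else_)
  open import Data.Vec as Vec using (Vec; _∷_; lookup)
  import Data.Vec.Properties as VecP
  open import Data.Product using (_,_)
  open import Data.Empty using (⊥-elim)
  open import Relation.Nullary.Decidable using (⌊_⌋)
  open import Relation.Binary.PropositionalEquality
  open BooleanCounting
  open Orbits
  open Insertion

  insertV : ∀ {n k} → Vec (Fin n) k → Fin k → Vec (Fin (suc n)) k
  insertV (x ∷ g) zero = zero ∷ Vec.map suc g
  insertV (x ∷ g) (suc b) = suc x ∷ insertV g b

  insertTable : ∀ {n} → Vec (Fin n) n → Fin n → Vec (Fin (suc n)) (suc n)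
  insertTable g b = suc (lookup g b) ∷ insertV g b

  lookup-insertV : ∀ {n k} (g : Vec (Fin n) k) b i → lookup (insertV g b) i ≡ (if ⌊ i Fin.≟ b ⌋ then zero else suc (lookup g i))
  lookup-insertV (x ∷ g) zero zero = refl
  lookup-insertV (x ∷ g) zero (suc i) = VecP.lookup-map i suc g
  lookup-insertV (x ∷ g) (suc b) zero = refl
  lookup-insertV (x ∷ g) (suc b) (suc i) = trans (lookup-insertV g b i) (cong (λ c → if c then zero else suc (lookup g i)) (sym (suc-≟ i b)))

  lookup-insertTable : ∀ {n} (g : Vec (Fin n) n) b x → lookup (insertTable g b) x ≡ insertAfter (lookup g) b x
  lookup-insertTable g b zero = refl
  lookup-insertTable g b (suc i) = lookup-insertV g b i

  lookup-addFixed : ∀ {n} (g : Vec (Fin n) n) x → lookup (zero ∷ Vec.map suc g) x ≡ addFixed (lookup g) x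
  lookup-addFixed g zero = refl
  lookup-addFixed g (suc i) = VecP.lookup-map i suc g

  zero-fixed-and-hit : ∀ {n} (w : Vec (Fin (suc n)) n) p → lookup w p ≡ zero → isInjectiveᵇ (lookup (zero ∷ w)) ≡ false
  zero-fixed-and-hit w p e = collision⇒¬injectiveᵇ (lookup (zero ∷ w)) zero (suc p) (λ ()) (sym e)

  zero-hit-twice : ∀ {n} (x : Fin (suc n)) (w : Vec (Fin (suc n)) n) p q → p ≢ q → lookup w p ≡ zero → lookup w q ≡ zero → isInjectiveᵇ (lookup (x ∷ w)) ≡ false
  zero-hit-twice x w p q ne ep eq = collision⇒¬injectiveᵇ (lookup (x ∷ w)) (suc p) (suc q) (λ e → ne (FinP.suc-injective e)) (trans ep (sym eq))

  dropZero : ∀ {n} → Fin n → Fin (suc n) → Fin n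
  dropZero a zero = a
  dropZero a (suc y) = y

  -- a table with nonzero first entry and no entry 0 is not injective: it maps
  -- the n+1 points into the n values 1, …, n
  zero-never-hit : ∀ {n} (a : Fin n) (w : Vec (Fin (suc n)) n) → (∀ p → lookup w p ≢ zero) → isInjectiveᵇ (lookup (suc a ∷ w)) ≡ false
  zero-never-hit {n} a w nz with FinP.pigeonhole (ℕP.n<1+n n) (λ x → dropZero a (lookup (suc a ∷ w) x))
  ... | i , j , i<j , e = collision⇒¬injectiveᵇ f i j (FinP.<⇒≢ i<j) (trans (shifted-value i) (trans (cong suc e) (sym (shifted-value j))))
    where
    f : Fin (suc n) → Fin (suc n)
    f = lookup (suc a ∷ w)
    shifted-value : ∀ x → f x ≡ suc (dropZero a (f x))
    shifted-value zero = refl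
    shifted-value (suc p) with lookup w p in eq
    ... | zero = ⊥-elim (nz p eq)
    ... | suc y = refl



module TableSums {c ℓ} (R : CommutativeRing c ℓ) where

  open import Data.Nat using (zero; suc; _∸_)
  import Data.Nat.Properties as ℕP
  open import Data.Fin using (Fin; zero; suc)
  import Data.Fin.Properties as FinP
  open import Data.Bool using (Bool; true; false; if_then_else_)
  open import Data.List as List using (List; []; _∷_; map; filterᵇ; tabulate; concatMap; allFin)
  import Data.List.Properties as ListP
  open import Data.Vec as Vec using (Vec; []; _∷_; lookup)
  open import Relation.Binary.PropositionalEquality as ≡ using (_≡_; _≢_)
  open RingArithmetic R hiding (zero)
  open BooleanCounting
  open Tables

  sumL-cong : ∀ {a} {A : Set a} (xs : List A) {F G : A → Carrier} → (∀ x → F x ≈ G x) → sumL (map F xs) ≈ sumL (map G xs)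
  sumL-cong [] h = refl
  sumL-cong (x ∷ xs) h = +-cong (h x) (sumL-cong xs h)

  sumL-++ : ∀ {a} {A : Set a} (xs ys : List A) (F : A → Carrier) → sumL (map F (xs List.++ ys)) ≈ sumL (map F xs) + sumL (map F ys)
  sumL-++ [] ys F = sym (+-identityˡ _)
  sumL-++ (x ∷ xs) ys F = trans (+-congˡ (sumL-++ xs ys F)) (sym (+-assoc _ _ _))

  sumL-concatMap : ∀ {a b} {A : Set a} {B' : Set b} (G : A → List B') (F : B' → Carrier) (xs : List A) →
    sumL (map F (concatMap G xs)) ≈ sumL (map (λ x → sumL (map F (G x))) xs)
  sumL-concatMap G F [] = refl
  sumL-concatMap G F (x ∷ xs) = trans (sumL-++ (G x) (concatMap G xs) F) (+-congˡ (sumL-concatMap G F xs))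

  sumL-map : ∀ {a b} {A : Set a} {B' : Set b} (G : A → B') (F : B' → Carrier) (xs : List A) → sumL (map F (map G xs)) ≡ sumL (map (λ x → F (G x)) xs)
  sumL-map G F xs = ≡.cong sumL (≡.sym (ListP.map-∘ xs))

  sumL-filter : ∀ {a} {A : Set a} (p : A → Bool) (F : A → Carrier) (xs : List A) →
    sumL (map F (filterᵇ p xs)) ≈ sumL (map (λ x → if p x then F x else 0#) xs)
  sumL-filter p F [] = refl
  sumL-filter p F (x ∷ xs) with p x
  ... | true = +-congˡ (sumL-filter p F xs)
  ... | false = trans (sumL-filter p F xs) (sym (+-identityˡ _))

  abstract
    -- sum over Fin n; abstract to keep goals small
    ΣF : ∀ n → (Fin n → Carrier) → Carrier
    ΣF zero g = 0#
    ΣF (suc n) g = g zero + ΣF n (λ i → g (suc i))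

    ΣF-zero : ∀ g → ΣF 0 g ≈ 0#
    ΣF-zero g = refl

    ΣF-suc : ∀ n g → ΣF (suc n) g ≈ g zero + ΣF n (λ i → g (suc i))
    ΣF-suc n g = refl

    sumL-tab : ∀ {a} {A : Set a} n (h : Fin n → A) (g : A → Carrier) → sumL (map g (tabulate h)) ≈ ΣF n (λ i → g (h i))
    sumL-tab zero h g = refl
    sumL-tab (suc n) h g = +-congˡ (sumL-tab n (λ i → h (suc i)) g)

    ΣF-cong : ∀ n {f g : Fin n → Carrier} → (∀ i → f i ≈ g i) → ΣF n f ≈ ΣF n g
    ΣF-cong zero h = refl
    ΣF-cong (suc n) h = +-cong (h zero) (ΣF-cong n (λ i → h (suc i)))

    ΣF-+ : ∀ n (f g : Fin n → Carrier) → ΣF n (λ i → f i + g i) ≈ ΣF n f + ΣF n g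
    ΣF-+ zero f g = sym (+-identityʳ 0#)
    ΣF-+ (suc n) f g = trans (+-congˡ (ΣF-+ n _ _)) (solve 4 (λ a b c d → (a :+ b) :+ (c :+ d) := (a :+ c) :+ (b :+ d)) refl _ _ _ _)

    ΣF-*ˡ : ∀ n x (f : Fin n → Carrier) → ΣF n (λ i → x * f i) ≈ x * ΣF n f
    ΣF-*ˡ zero x f = sym (zeroʳ x)
    ΣF-*ˡ (suc n) x f = trans (+-congˡ (ΣF-*ˡ n x _)) (sym (distribˡ _ _ _))

    ΣF-0 : ∀ n {f : Fin n → Carrier} → (∀ i → f i ≈ 0#) → ΣF n f ≈ 0#
    ΣF-0 zero h = refl
    ΣF-0 (suc n) h = trans (+-cong (h zero) (ΣF-0 n (λ i → h (suc i)))) (+-identityʳ 0#)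

    ΣF-swap : ∀ n m (f : Fin n → Fin m → Carrier) → ΣF n (λ i → ΣF m (λ j → f i j)) ≈ ΣF m (λ j → ΣF n (λ i → f i j))
    ΣF-swap zero m f = sym (ΣF-0 m (λ _ → refl))
    ΣF-swap (suc n) m f = trans (+-congˡ (ΣF-swap n m _)) (sym (ΣF-+ m _ _))

  ΣT : ∀ n k → (Vec (Fin n) k → Carrier) → Carrier
  ΣT n zero F = F []
  ΣT n (suc k) F = ΣT n k (λ w → ΣF n (λ x → F (x ∷ w)))

  sumL-tables : ∀ n k (F : Vec (Fin n) k → Carrier) → sumL (map F (tables n k)) ≈ ΣT n k F
  sumL-tables n zero F = +-identityʳ _
  sumL-tables n (suc k) F = begin
    sumL (map F (concatMap (λ v → map (Vec._∷ v) (allFin n)) (tables n k)))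
      ≈⟨ sumL-concatMap (λ v → map (Vec._∷ v) (allFin n)) F (tables n k) ⟩
    sumL (map (λ v → sumL (map F (map (Vec._∷ v) (allFin n)))) (tables n k))
      ≈⟨ sumL-cong (tables n k) (λ v → trans (≡⇒≈ (sumL-map (Vec._∷ v) F (allFin n))) (sumL-tab n (λ i → i) (λ x → F (x ∷ v)))) ⟩
    sumL (map (λ v → ΣF n (λ x → F (x ∷ v))) (tables n k))
      ≈⟨ sumL-tables n k _ ⟩
    ΣT n (suc k) F ∎

  ΣT-cong : ∀ n k {F G : Vec (Fin n) k → Carrier} → (∀ w → F w ≈ G w) → ΣT n k F ≈ ΣT n k G
  ΣT-cong n zero h = h []
  ΣT-cong n (suc k) h = ΣT-cong n k (λ w → ΣF-cong n (λ x → h (x ∷ w)))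

  ΣT-+ : ∀ n k (F G : Vec (Fin n) k → Carrier) → ΣT n k (λ w → F w + G w) ≈ ΣT n k F + ΣT n k G
  ΣT-+ n zero F G = refl
  ΣT-+ n (suc k) F G = trans (ΣT-cong n k (λ w → ΣF-+ n (λ x → F (x ∷ w)) (λ x → G (x ∷ w))))
    (ΣT-+ n k (λ w → ΣF n (λ x → F (x ∷ w))) (λ w → ΣF n (λ x → G (x ∷ w))))

  ΣT-*ˡ : ∀ n k x (F : Vec (Fin n) k → Carrier) → ΣT n k (λ w → x * F w) ≈ x * ΣT n k F
  ΣT-*ˡ n zero x F = refl
  ΣT-*ˡ n (suc k) x F = trans (ΣT-cong n k (λ w → ΣF-*ˡ n x (λ y → F (y ∷ w)))) (ΣT-*ˡ n k x (λ w → ΣF n (λ y → F (y ∷ w))))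

  ΣT-0 : ∀ n k {F : Vec (Fin n) k → Carrier} → (∀ w → F w ≈ 0#) → ΣT n k F ≈ 0#
  ΣT-0 n zero h = h []
  ΣT-0 n (suc k) h = ΣT-0 n k (λ w → ΣF-0 n (λ x → h (x ∷ w)))

  ΣFT-swap : ∀ m n k (F : Fin m → Vec (Fin n) k → Carrier) → ΣF m (λ i → ΣT n k (λ w → F i w)) ≈ ΣT n k (λ w → ΣF m (λ i → F i w))
  ΣFT-swap m n zero F = refl
  ΣFT-swap m n (suc k) F = trans (ΣFT-swap m n k (λ i w → ΣF n (λ x → F i (x ∷ w))))
    (ΣT-cong n k (λ w → ΣF-swap m n (λ i x → F i (x ∷ w))))

  ΣT-avoid-zero : ∀ n k (H : Vec (Fin (suc n)) k → Carrier) → (∀ w p → lookup w p ≡ zero → H w ≈ 0#) →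
    ΣT (suc n) k H ≈ ΣT n k (λ g → H (Vec.map suc g))
  ΣT-avoid-zero n zero H hz = refl
  ΣT-avoid-zero n (suc k) H hz = begin
    ΣT (suc n) k (λ w → ΣF (suc n) (λ x → H (x ∷ w)))
      ≈⟨ ΣT-cong (suc n) k (λ w → trans (ΣF-suc n (λ x → H (x ∷ w))) (trans (+-congʳ (hz (zero ∷ w) zero ≡.refl)) (+-identityˡ _))) ⟩
    ΣT (suc n) k (λ w → ΣF n (λ x → H (suc x ∷ w)))
      ≈⟨ ΣT-avoid-zero n k (λ w → ΣF n (λ x → H (suc x ∷ w))) (λ w p e → ΣF-0 n (λ x → hz (suc x ∷ w) (suc p) e)) ⟩
    ΣT n (suc k) (λ g → H (Vec.map suc g)) ∎

  ΣT-hit-zero-once : ∀ n k (H : Fin n → Vec (Fin (suc n)) k → Carrier) →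
    (∀ a' w → (∀ p → lookup w p ≢ zero) → H a' w ≈ 0#) →
    (∀ a' w p q → p ≢ q → lookup w p ≡ zero → lookup w q ≡ zero → H a' w ≈ 0#) →
    ΣF n (λ a' → ΣT (suc n) k (λ w → H a' w)) ≈ ΣF k (λ b → ΣT n k (λ g → H (lookup g b) (insertV g b)))
  ΣT-hit-zero-once n zero H h0 h2 = trans (ΣF-0 n (λ a' → h0 a' [] (λ ()))) (sym (ΣF-zero _))
  ΣT-hit-zero-once n (suc k) H h0 h2 = begin
    ΣF n (λ a' → ΣT (suc n) k (λ w → ΣF (suc n) (λ x → H a' (x ∷ w))))
      ≈⟨ ΣF-cong n (λ a' → trans (ΣT-cong (suc n) k (λ w → ΣF-suc n (λ x → H a' (x ∷ w))))
                                   (ΣT-+ (suc n) k (λ w → H a' (zero ∷ w)) (λ w → ΣF n (λ x → H a' (suc x ∷ w))))) ⟩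
    ΣF n (λ a' → ΣT (suc n) k (λ w → H a' (zero ∷ w)) + ΣT (suc n) k (λ w → ΣF n (λ x → H a' (suc x ∷ w))))
      ≈⟨ ΣF-+ n _ _ ⟩
    ΣF n (λ a' → ΣT (suc n) k (λ w → H a' (zero ∷ w))) + ΣF n (λ a' → ΣT (suc n) k (λ w → ΣF n (λ x → H a' (suc x ∷ w))))
      ≈⟨ +-cong partZ partS ⟩
    ΣT n (suc k) (λ g → H (lookup g zero) (insertV g zero)) + ΣF k (λ b → ΣT n (suc k) (λ g → H (lookup g (suc b)) (insertV g (suc b))))
      ≈⟨ sym (ΣF-suc k (λ b → ΣT n (suc k) (λ g → H (lookup g b) (insertV g b)))) ⟩
    ΣF (suc k) (λ b → ΣT n (suc k) (λ g → H (lookup g b) (insertV g b))) ∎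
    where
    partZ : ΣF n (λ a' → ΣT (suc n) k (λ w → H a' (zero ∷ w))) ≈ ΣT n (suc k) (λ g → H (lookup g zero) (insertV g zero))
    partZ = trans (ΣF-cong n (λ a' → ΣT-avoid-zero n k (λ w → H a' (zero ∷ w)) (λ w p e → h2 a' (zero ∷ w) zero (suc p) (λ ()) ≡.refl e)))
                  (ΣFT-swap n n k (λ a' g → H a' (zero ∷ Vec.map suc g)))
    partS : ΣF n (λ a' → ΣT (suc n) k (λ w → ΣF n (λ x → H a' (suc x ∷ w)))) ≈ ΣF k (λ b → ΣT n (suc k) (λ g → H (lookup g (suc b)) (insertV g (suc b))))
    partS = ΣT-hit-zero-once n k (λ a' w → ΣF n (λ x → H a' (suc x ∷ w)))
              (λ a' w nz → ΣF-0 n (λ x → h0 a' (suc x ∷ w) (λ { zero () ; (suc p) e → nz p e })))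
              (λ a' w p q ne ep eq → ΣF-0 n (λ x → h2 a' (suc x ∷ w) (suc p) (suc q) (λ e → ne (FinP.suc-injective e)) ep eq))

  ΣF-if : ∀ n (p : Fin n → Bool) X Y → ΣF n (λ b → if p b then X else Y) ≈ fromℕ (count p) * X + fromℕ (n ∸ count p) * Y
  ΣF-if zero p X Y = trans (ΣF-zero _) (solve 2 (λ x y → con (ℤ.+ 0) := con (ℤ.+ 0) :* x :+ con (ℤ.+ 0) :* y) refl X Y)
    where import Data.Integer as ℤ
  ΣF-if (suc n) p X Y with p zero in e
  ... | true = trans (ΣF-suc n _) (trans (+-congʳ (≡⇒≈ (≡.cong (λ b → if b then X else Y) e)))
      (trans (+-congˡ (ΣF-if n (λ i → p (suc i)) X Y))
      (solve 4 (λ x y c d → x :+ (c :* x :+ d :* y) := (con (ℤ.+ 1) :+ c) :* x :+ d :* y) refl X Y (fromℕ (count (λ i → p (suc i)))) (fromℕ (n ∸ count (λ i → p (suc i)))))))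
    where import Data.Integer as ℤ
  ... | false = trans (ΣF-suc n _) (trans (+-congʳ (≡⇒≈ (≡.cong (λ b → if b then X else Y) e)))
      (trans (+-congˡ (ΣF-if n (λ i → p (suc i)) X Y))
      (trans (solve 4 (λ x y c d → y :+ (c :* x :+ d :* y) := c :* x :+ (con (ℤ.+ 1) :+ d) :* y) refl X Y (fromℕ (count (λ i → p (suc i)))) (fromℕ (n ∸ count (λ i → p (suc i)))))
        (+-congˡ (*-congʳ (≡⇒≈ (≡.cong fromℕ (≡.sym (ℕP.+-∸-assoc 1 (count≤ (λ i → p (suc i))))))))))))
    where import Data.Integer as ℤ

-- Fix n 0 is the
-- derangement polynomial, and removing the point 0 from a permutation of
-- [n+1] gives the recursion
--   Fix (n+1) k = Fix n (k-1) + (k+1) a Fix n (k+1) + (n-k) Fix n k.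
module FixedPointSums {c ℓ} (R : CommutativeRing c ℓ) (a : CommutativeRing.Carrier R) where

  open import Data.Nat as ℕ using (zero; suc; _∸_; _≡ᵇ_)
  import Data.Nat.Properties as ℕP
  open import Data.Fin as Fin using (Fin; zero; suc)
  open import Data.Bool using (Bool; true; false; _∧_; if_then_else_)
  open import Data.Bool.Properties using (∧-zeroʳ)
  open import Data.List using (map; filterᵇ)
  open import Data.Vec as Vec using (Vec; _∷_; lookup)
  open import Data.Empty using (⊥-elim)
  open import Relation.Nullary using (yes; no)
  open import Relation.Nullary.Decidable using (⌊_⌋)
  open import Relation.Binary.PropositionalEquality as ≡ using (_≡_; _≢_)
  open RingArithmetic R hiding (zero)
  open FiniteSums R using (previous)
  open Orbits
  open CycleStatistics
  open Insertion
  open Tables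
  open TableSums R

  weightOf : ℕ → ∀ {n} → (Fin n → Fin n) → Carrier
  weightOf k f = if isInjectiveᵇ f ∧ (fixedCount f ≡ᵇ k) then a ^ cycleCount f else 0#

  tableWeight : ℕ → ∀ {n} → Vec (Fin n) n → Carrier
  tableWeight k v = weightOf k (lookup v)

  Fix : ℕ → ℕ → Carrier
  Fix n k = ΣT n n (tableWeight k)

  weightOf-ext : ∀ k {n} {f g : Fin n → Fin n} → (∀ x → f x ≡ g x) → weightOf k f ≡ weightOf k g
  weightOf-ext k h rewrite injectiveᵇ-ext h | fixedCount-ext h | cycleCount-ext h = ≡.refl

  weightOf-noninjective : ∀ k {n} (f : Fin n → Fin n) → isInjectiveᵇ f ≡ false → weightOf k f ≈ 0#
  weightOf-noninjective k f e rewrite e = refl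

  if-cong : ∀ {b b' : Bool} {x x'} → b ≡ b' → x ≈ x' → (if b then x else 0#) ≈ (if b' then x' else 0#)
  if-cong {true}  ≡.refl h = h
  if-cong {false} ≡.refl h = refl

  if-true : ∀ {b x} → b ≡ true → (if b then x else 0#) ≈ x
  if-true ≡.refl = refl

  if-false : ∀ {b x} → b ≡ false → (if b then x else 0#) ≈ 0#
  if-false ≡.refl = refl

  ≡ᵇ-refl : ∀ m → (m ≡ᵇ m) ≡ true
  ≡ᵇ-refl zero    = ≡.refl
  ≡ᵇ-refl (suc m) = ≡ᵇ-refl m

  ≢⇒≡ᵇ-false : ∀ {m n} → m ≢ n → (m ≡ᵇ n) ≡ false
  ≢⇒≡ᵇ-false {zero}  {zero}  ne = ⊥-elim (ne ≡.refl)
  ≢⇒≡ᵇ-false {zero}  {suc n} ne = ≡.refl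
  ≢⇒≡ᵇ-false {suc m} {zero}  ne = ≡.refl
  ≢⇒≡ᵇ-false {suc m} {suc n} ne = ≢⇒≡ᵇ-false (λ e → ne (≡.cong suc e))

  derangement-weight : ∀ {n} (f : Fin n → Fin n) →
    (if isInjectiveᵇ f ∧ isFixedPointFreeᵇ f then a ^ cyc f else 0#) ≈ weightOf 0 f
  derangement-weight f with isInjectiveᵇ f
  ... | false = refl
  ... | true with isFixedPointFreeᵇ f in e
  ... | true  = ≈-if-true (≡.trans (≡.sym (fixedPointFreeᵇ≡ f)) e) (≡⇒≈ (≡.cong (a ^_) (cyc≡cycleCount f e)))
    where
    ≈-if-true : ∀ {b x y} → b ≡ true → x ≈ y → x ≈ (if b then y else 0#)
    ≈-if-true ≡.refl h = h
  ... | false = sym (if-false (≡.trans (≡.sym (fixedPointFreeᵇ≡ f)) e))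

  D≈Fix0 : ∀ n → D a n ≈ Fix n 0
  D≈Fix0 n = begin
    sumL (map (λ v → a ^ cyc (lookup v)) (filterᵇ isDerangement (tables n n)))
      ≈⟨ sumL-filter isDerangement (λ v → a ^ cyc (lookup v)) (tables n n) ⟩
    sumL (map (λ v → if isDerangement v then a ^ cyc (lookup v) else 0#) (tables n n))
      ≈⟨ sumL-tables n n _ ⟩
    ΣT n n (λ v → if isDerangement v then a ^ cyc (lookup v) else 0#)
      ≈⟨ ΣT-cong n n (λ v → derangement-weight (lookup v)) ⟩
    Fix n 0 ∎
    where
    isDerangement : Vec (Fin n) n → Bool
    isDerangement v = isInjectiveᵇ (lookup v) ∧ isFixedPointFreeᵇ (lookup v)

  -- permutations of [n+1] fixing 0 correspond to permutations of [n], with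
  -- one fixed point more
  weight-addFixed : ∀ k {n} (g : Vec (Fin n) n) →
    tableWeight k (zero ∷ Vec.map suc g) ≈ previous (λ j → tableWeight j g) k
  weight-addFixed k g =
    trans (≡⇒≈ (weightOf-ext k (lookup-addFixed g)))
      (trans (if-cong (≡.cong₂ _∧_ (injectiveᵇ-addFixed (lookup g)) (≡.cong (_≡ᵇ k) (fixedCount-addFixed (lookup g))))
                      (≡⇒≈ (≡.cong (a ^_) (cycleCount-addFixed (lookup g)))))
        (shifted k))
    where
    shifted : ∀ k → (if isInjectiveᵇ (lookup g) ∧ (suc (fixedCount (lookup g)) ≡ᵇ k) then a ^ cycleCount (lookup g) else 0#)
                    ≈ previous (λ j → tableWeight j g) k
    shifted zero    = if-cong (∧-zeroʳ (isInjectiveᵇ (lookup g))) refl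
    shifted (suc k) = refl

  ΣT-previous : ∀ n k → ΣT n n (λ g → previous (λ j → tableWeight j g) k) ≈ previous (Fix n) k
  ΣT-previous n zero    = ΣT-0 n n (λ _ → refl)
  ΣT-previous n (suc k) = refl

  weight-insertAfter-at : ∀ k {n} (g : Fin n → Fin n) → IsInjective g → ∀ b →
    weightOf k (insertAfter g b)
      ≈ (if ⌊ g b Fin.≟ b ⌋ then (if ℕ.pred (fixedCount g) ≡ᵇ k then a * a ^ cycleCount g else 0#)
                            else (if fixedCount g ≡ᵇ k then a ^ cycleCount g else 0#))
  weight-insertAfter-at k g inj b with ⌊ g b Fin.≟ b ⌋ in fixed
  ... | true =
    if-cong (≡.cong₂ _∧_ injective (≡.cong (_≡ᵇ k) (≡.cong ℕ.pred (≡.sym fixed-points))))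
            (≡⇒≈ (≡.cong (a ^_) (≡.trans cycles (ℕP.+-comm (cycleCount g) 1))))
    where
    injective : isInjectiveᵇ (insertAfter g b) ≡ true
    injective = ≡.trans (injectiveᵇ-insertAfter g b) (injectiveᵇ-complete g inj)
    fixed-points : fixedCount g ≡ 1 ℕ.+ fixedCount (insertAfter g b)
    fixed-points = ≡.subst (λ t → fixedCount g ≡ (if t then 1 else 0) ℕ.+ fixedCount (insertAfter g b)) fixed
                     (fixedCount-insertAfter g b)
    cycles : cycleCount (insertAfter g b) ≡ cycleCount g ℕ.+ 1
    cycles = ≡.subst (λ t → cycleCount (insertAfter g b) ≡ cycleCount g ℕ.+ (if t then 1 else 0)) fixed
               (cycleCount-insertAfter g inj b)
  ... | false =
    if-cong (≡.cong₂ _∧_ injective (≡.cong (_≡ᵇ k) (≡.sym fixed-points)))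
            (≡⇒≈ (≡.cong (a ^_) (≡.trans cycles (ℕP.+-identityʳ (cycleCount g)))))
    where
    injective : isInjectiveᵇ (insertAfter g b) ≡ true
    injective = ≡.trans (injectiveᵇ-insertAfter g b) (injectiveᵇ-complete g inj)
    fixed-points : fixedCount g ≡ 0 ℕ.+ fixedCount (insertAfter g b)
    fixed-points = ≡.subst (λ t → fixedCount g ≡ (if t then 1 else 0) ℕ.+ fixedCount (insertAfter g b)) fixed
                     (fixedCount-insertAfter g b)
    cycles : cycleCount (insertAfter g b) ≡ cycleCount g ℕ.+ 0
    cycles = ≡.subst (λ t → cycleCount (insertAfter g b) ≡ cycleCount g ℕ.+ (if t then 1 else 0)) fixed
               (cycleCount-insertAfter g inj b)

  -- summing over b: fc insertion points are fixed points of g, n - fc are not;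
  -- only permutations with fc = k+1, resp. fc = k, contribute
  regroup : ∀ n k fc (w : Carrier) →
    fromℕ fc * (if ℕ.pred fc ≡ᵇ k then a * w else 0#) + fromℕ (n ∸ fc) * (if fc ≡ᵇ k then w else 0#)
      ≈ fromℕ (suc k) * (a * (if fc ≡ᵇ suc k then w else 0#)) + fromℕ (n ∸ k) * (if fc ≡ᵇ k then w else 0#)
  regroup n k fc w with fc ℕP.≟ suc k | fc ℕP.≟ k
  ... | yes ≡.refl | _ = begin
    fromℕ (suc k) * (if k ≡ᵇ k then a * w else 0#) + fromℕ (n ∸ suc k) * (if suc k ≡ᵇ k then w else 0#)
      ≈⟨ +-cong (*-congˡ (if-true (≡ᵇ-refl k))) (trans (*-congˡ (if-false (≢⇒≡ᵇ-false {suc k} {k} ℕP.1+n≢n))) (zeroʳ _)) ⟩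
    fromℕ (suc k) * (a * w) + 0#
      ≈⟨ sym (+-cong (*-congˡ (*-congˡ (if-true (≡ᵇ-refl k)))) (trans (*-congˡ (if-false (≢⇒≡ᵇ-false {suc k} {k} ℕP.1+n≢n))) (zeroʳ _))) ⟩
    fromℕ (suc k) * (a * (if suc k ≡ᵇ suc k then w else 0#)) + fromℕ (n ∸ k) * (if suc k ≡ᵇ k then w else 0#) ∎
  ... | no _ | yes ≡.refl = begin
    fromℕ fc * (if ℕ.pred fc ≡ᵇ fc then a * w else 0#) + fromℕ (n ∸ fc) * (if fc ≡ᵇ fc then w else 0#)
      ≈⟨ +-cong (no-predecessor fc) (*-congˡ (if-true (≡ᵇ-refl fc))) ⟩
    0# + fromℕ (n ∸ fc) * w
      ≈⟨ sym (+-cong (trans (*-congˡ (trans (*-congˡ (if-false (≢⇒≡ᵇ-false {fc} {suc fc} n≢1+n))) (zeroʳ a))) (zeroʳ _))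
                     (*-congˡ (if-true (≡ᵇ-refl fc)))) ⟩
    fromℕ (suc fc) * (a * (if fc ≡ᵇ suc fc then w else 0#)) + fromℕ (n ∸ fc) * (if fc ≡ᵇ fc then w else 0#) ∎
    where
    n≢1+n : ∀ {m} → m ≢ suc m
    n≢1+n e = ℕP.1+n≢n (≡.sym e)
    no-predecessor : ∀ m → fromℕ m * (if ℕ.pred m ≡ᵇ m then a * w else 0#) ≈ 0#
    no-predecessor zero    = zeroˡ _
    no-predecessor (suc m) = trans (*-congˡ (if-false (≢⇒≡ᵇ-false {m} {suc m} n≢1+n))) (zeroʳ _)
  ... | no fc≢1+k | no fc≢k =
    trans (+-cong (trans (*-congˡ (if-false (≢⇒≡ᵇ-false pred≢k))) (zeroʳ _))
                  (trans (*-congˡ (if-false (≢⇒≡ᵇ-false fc≢k))) (zeroʳ _)))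
      (sym (+-cong (trans (*-congˡ (trans (*-congˡ (if-false (≢⇒≡ᵇ-false fc≢1+k))) (zeroʳ a))) (zeroʳ _))
                   (trans (*-congˡ (if-false (≢⇒≡ᵇ-false fc≢k))) (zeroʳ _))))
    where
    pred≢ : ∀ {m} → m ≢ suc k → m ≢ k → ℕ.pred m ≢ k
    pred≢ {zero}  _    m≢k e = m≢k e
    pred≢ {suc m} m≢1+k _  e = m≢1+k (≡.cong suc e)
    pred≢k : ℕ.pred fc ≢ k
    pred≢k = pred≢ fc≢1+k fc≢k

  weight-insertAfter : ∀ k {n} (g : Vec (Fin n) n) →
    ΣF n (λ b → tableWeight k (insertTable g b)) ≈ fromℕ (suc k) * (a * tableWeight (suc k) g) + fromℕ (n ∸ k) * tableWeight k g
  weight-insertAfter k {n} g with isInjectiveᵇ (lookup g) in injective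
  ... | false = begin
    ΣF n (λ b → tableWeight k (insertTable g b))
      ≈⟨ ΣF-0 n (λ b → trans (≡⇒≈ (weightOf-ext k (lookup-insertTable g b)))
                        (weightOf-noninjective k (insertAfter (lookup g) b) (≡.trans (injectiveᵇ-insertAfter (lookup g) b) injective))) ⟩
    0#
      ≈⟨ solve 3 (λ x y a → con (ℤ.+ 0) := x :* (a :* con (ℤ.+ 0)) :+ y :* con (ℤ.+ 0)) refl (fromℕ (suc k)) (fromℕ (n ∸ k)) a ⟩
    fromℕ (suc k) * (a * 0#) + fromℕ (n ∸ k) * 0# ∎
    where import Data.Integer as ℤ
  ... | true = begin
    ΣF n (λ b → tableWeight k (insertTable g b))
      ≈⟨ ΣF-cong n (λ b → trans (≡⇒≈ (weightOf-ext k (lookup-insertTable g b)))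
                           (weight-insertAfter-at k f (injectiveᵇ-sound f injective) b)) ⟩
    ΣF n (λ b → if ⌊ f b Fin.≟ b ⌋ then (if ℕ.pred fc ≡ᵇ k then a * w else 0#) else (if fc ≡ᵇ k then w else 0#))
      ≈⟨ ΣF-if n (λ b → ⌊ f b Fin.≟ b ⌋) _ _ ⟩
    fromℕ fc * (if ℕ.pred fc ≡ᵇ k then a * w else 0#) + fromℕ (n ∸ fc) * (if fc ≡ᵇ k then w else 0#)
      ≈⟨ regroup n k fc w ⟩
    fromℕ (suc k) * (a * (if fc ≡ᵇ suc k then w else 0#)) + fromℕ (n ∸ k) * (if fc ≡ᵇ k then w else 0#) ∎
    where
    f : Fin n → Fin n
    f = lookup g
    fc : ℕ
    fc = fixedCount f
    w : Carrier
    w = a ^ cycleCount f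

  -- the recursion for Fix, splitting according to the image of 0
  Fix-recurrence : ∀ n k → Fix (suc n) k ≈ previous (Fix n) k + (fromℕ (suc k) * (a * Fix n (suc k)) + fromℕ (n ∸ k) * Fix n k)
  Fix-recurrence n k = begin
    ΣT (suc n) n (λ w → ΣF (suc n) (λ x → tableWeight k (x ∷ w)))
      ≈⟨ ΣT-cong (suc n) n (λ w → ΣF-suc n (λ x → tableWeight k (x ∷ w))) ⟩
    ΣT (suc n) n (λ w → tableWeight k (zero ∷ w) + ΣF n (λ x → tableWeight k (suc x ∷ w)))
      ≈⟨ ΣT-+ (suc n) n _ _ ⟩
    ΣT (suc n) n (λ w → tableWeight k (zero ∷ w)) + ΣT (suc n) n (λ w → ΣF n (λ x → tableWeight k (suc x ∷ w)))
      ≈⟨ +-cong zero-fixed zero-moved ⟩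
    previous (Fix n) k + (fromℕ (suc k) * (a * Fix n (suc k)) + fromℕ (n ∸ k) * Fix n k) ∎
    where
    zero-fixed : ΣT (suc n) n (λ w → tableWeight k (zero ∷ w)) ≈ previous (Fix n) k
    zero-fixed =
      trans (ΣT-avoid-zero n n _ (λ w p e → weightOf-noninjective k (lookup (zero ∷ w)) (zero-fixed-and-hit w p e)))
        (trans (ΣT-cong n n (weight-addFixed k)) (ΣT-previous n k))
    -- permutations moving 0: 0 is inserted after its preimage b
    zero-moved : ΣT (suc n) n (λ w → ΣF n (λ x → tableWeight k (suc x ∷ w)))
                 ≈ fromℕ (suc k) * (a * Fix n (suc k)) + fromℕ (n ∸ k) * Fix n k
    zero-moved = begin
      ΣT (suc n) n (λ w → ΣF n (λ x → tableWeight k (suc x ∷ w)))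
        ≈⟨ sym (ΣFT-swap n (suc n) n _) ⟩
      ΣF n (λ x → ΣT (suc n) n (λ w → tableWeight k (suc x ∷ w)))
        ≈⟨ ΣT-hit-zero-once n n _ (λ x w nz → weightOf-noninjective k (lookup (suc x ∷ w)) (zero-never-hit x w nz))
             (λ x w p q ne ep eq → weightOf-noninjective k (lookup (suc x ∷ w)) (zero-hit-twice (suc x) w p q ne ep eq)) ⟩
      ΣF n (λ b → ΣT n n (λ g → tableWeight k (insertTable g b)))
        ≈⟨ ΣFT-swap n n n _ ⟩
      ΣT n n (λ g → ΣF n (λ b → tableWeight k (insertTable g b)))
        ≈⟨ ΣT-cong n n (weight-insertAfter k) ⟩
      ΣT n n (λ g → fromℕ (suc k) * (a * tableWeight (suc k) g) + fromℕ (n ∸ k) * tableWeight k g)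
        ≈⟨ ΣT-+ n n _ _ ⟩
      ΣT n n (λ g → fromℕ (suc k) * (a * tableWeight (suc k) g)) + ΣT n n (λ g → fromℕ (n ∸ k) * tableWeight k g)
        ≈⟨ +-cong (trans (ΣT-*ˡ n n (fromℕ (suc k)) _) (*-congˡ (ΣT-*ˡ n n a (tableWeight (suc k)))))
                  (ΣT-*ˡ n n (fromℕ (n ∸ k)) (tableWeight k)) ⟩
      fromℕ (suc k) * (a * Fix n (suc k)) + fromℕ (n ∸ k) * Fix n k ∎

-- The closed form Fix n k = C(n,k) d_a(n-k): the right side satisfies the
-- recursion of Fix (using the recurrence of d and the absorption identities
-- for binomial coefficients) and the same initial values, so the two agree by
-- induction on n.
module FixedPointClosedForm {c ℓ} (R : CommutativeRing c ℓ) (a : CommutativeRing.Carrier R) where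

  open import Data.Nat as ℕ using (zero; suc; _≤_; _<_; _∸_; s≤s; z≤n)
  import Data.Nat.Properties as ℕP
  open import Data.Nat.Combinatorics using (nC1≡n)
  open import Relation.Binary.PropositionalEquality as ≡ using (_≡_)
  open import Relation.Nullary using (yes; no)
  open RingArithmetic R hiding (zero)
  open FiniteSums R using (previous)
  open Convolution R
  open DerangementSequence R
  open FixedPointSums R a

  closedForm : ℕ → ℕ → Carrier
  closedForm n k = binom n k * d a (n ∸ k)

  ClosedFormRecurrence : ℕ → ℕ → Set ℓ
  ClosedFormRecurrence n k = closedForm (suc n) k ≈ previous (closedForm n) k + (fromℕ (suc k) * (a * closedForm n (suc k)) + fromℕ (n ∸ k) * closedForm n k)

  d-cong : ∀ {x y} → x ≡ y → d a x ≈ d a y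
  d-cong e = ≡⇒≈ (≡.cong (d a) e)

  import Data.Integer as ℤ

  -- k = 0: the recurrence of d
  recurrence-at-0 : ∀ j → ClosedFormRecurrence j 0
  recurrence-at-0 zero = begin
    binom 1 0 * d a 1 ≈⟨ trans (*-congˡ (d-one a)) (zeroʳ _) ⟩
    0# ≈⟨ solve 3 (λ x y z → con (ℤ.+ 0) := con (ℤ.+ 0) :+ ((con (ℤ.+ 1) :+ con (ℤ.+ 0)) :* (x :* (con (ℤ.+ 0) :* y)) :+ con (ℤ.+ 0) :* z)) refl a (d a 0) (binom 0 0 * d a 0) ⟩
    0# + (fromℕ 1 * (a * (0# * d a 0)) + fromℕ 0 * (binom 0 0 * d a 0))
      ≈⟨ sym (+-congˡ (+-congʳ (*-congˡ (*-congˡ (*-congʳ (binom-big 0 1 (s≤s z≤n))))))) ⟩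
    0# + (fromℕ 1 * (a * (binom 0 1 * d a 0)) + fromℕ 0 * (binom 0 0 * d a 0)) ∎
  recurrence-at-0 (suc m) = begin
    binom (suc (suc m)) 0 * d a (suc (suc m)) ≈⟨ *-cong (binom-zero (suc (suc m))) (d-recurrence a m) ⟩
    1# * (fromℕ (suc m) * (d a (suc m) + a * d a m))
      ≈⟨ solve 4 (λ M x y a → con (ℤ.+ 1) :* (M :* (x :+ a :* y)) := con (ℤ.+ 0) :+ ((con (ℤ.+ 1) :+ con (ℤ.+ 0)) :* (a :* (M :* y)) :+ M :* (con (ℤ.+ 1) :* x))) refl (fromℕ (suc m)) (d a (suc m)) (d a m) a ⟩
    0# + (fromℕ 1 * (a * (fromℕ (suc m) * d a m)) + fromℕ (suc m) * (1# * d a (suc m)))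
      ≈⟨ sym (+-congˡ (+-cong (*-congˡ (*-congˡ (*-congʳ (≡⇒≈ (≡.cong fromℕ (nC1≡n (suc m))))))) (*-congˡ (*-congʳ (binom-zero (suc m)))))) ⟩
    0# + (fromℕ 1 * (a * (binom (suc m) 1 * d a m)) + fromℕ (suc m) * (binom (suc m) 0 * d a (suc m))) ∎

  -- the core computation for 1 ≤ k ≤ n, using the recurrence of d and
  -- (k+2) C(n,k+2) = (n-k-1) C(n,k+1)
  interior-step : ∀ k' j → binom (suc k' ℕ.+ j) (suc k') * d a (suc j)
                   ≈ fromℕ (suc (suc k')) * (a * (binom (suc k' ℕ.+ j) (suc (suc k')) * d a ((suc k' ℕ.+ j) ∸ suc (suc k'))))
                     + fromℕ j * (binom (suc k' ℕ.+ j) (suc k') * d a j)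
  interior-step k' zero = begin
    C1 * d a 1 ≈⟨ trans (*-congˡ (d-one a)) (zeroʳ _) ⟩
    0# ≈⟨ solve 4 (λ K a x y → con (ℤ.+ 0) := K :* (a :* (con (ℤ.+ 0) :* x)) :+ con (ℤ.+ 0) :* y) refl (fromℕ (suc (suc k'))) a (d a ((suc k' ℕ.+ 0) ∸ suc (suc k'))) (C1 * d a 0) ⟩
    fromℕ (suc (suc k')) * (a * (0# * d a ((suc k' ℕ.+ 0) ∸ suc (suc k')))) + fromℕ 0 * (C1 * d a 0)
      ≈⟨ sym (+-congʳ (*-congˡ (*-congˡ (*-congʳ (binom-big (suc k' ℕ.+ 0) (suc (suc k')) lt))))) ⟩
    fromℕ (suc (suc k')) * (a * (binom (suc k' ℕ.+ 0) (suc (suc k')) * d a ((suc k' ℕ.+ 0) ∸ suc (suc k')))) + fromℕ 0 * (C1 * d a 0) ∎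
    where
    C1 : Carrier
    C1 = binom (suc k' ℕ.+ 0) (suc k')
    lt : suc k' ℕ.+ 0 < suc (suc k')
    lt = s≤s (s≤s (ℕP.≤-reflexive (ℕP.+-identityʳ k')))
  interior-step k' (suc j') = begin
    C1 * d a (suc (suc j')) ≈⟨ *-congˡ (d-recurrence a j') ⟩
    C1 * (J * (d a (suc j') + a * d a j'))
      ≈⟨ solve 5 (λ c J x y a → c :* (J :* (x :+ a :* y)) := (J :* c) :* (a :* y) :+ J :* (c :* x)) refl C1 J (d a (suc j')) (d a j') a ⟩
    (J * C1) * (a * d a j') + J * (C1 * d a (suc j'))
      ≈⟨ +-congʳ (*-congʳ (sym (binom-trade (suc k') (suc j')))) ⟩
    (K * C2) * (a * d a j') + J * (C1 * d a (suc j'))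
      ≈⟨ +-congʳ (solve 4 (λ K c a y → (K :* c) :* (a :* y) := K :* (a :* (c :* y))) refl K C2 a (d a j')) ⟩
    K * (a * (C2 * d a j')) + J * (C1 * d a (suc j'))
      ≈⟨ +-congʳ (*-congˡ (*-congˡ (*-congˡ (d-cong (≡.sym e3))))) ⟩
    K * (a * (C2 * d a (n ∸ suc (suc k')))) + J * (C1 * d a (suc j')) ∎
    where
    n : ℕ
    n = suc k' ℕ.+ suc j'
    C1 C2 J K : Carrier
    C1 = binom n (suc k')
    C2 = binom n (suc (suc k'))
    J = fromℕ (suc j')
    K = fromℕ (suc (suc k'))
    en : n ≡ suc (suc k') ℕ.+ j'
    en = ≡.cong suc (ℕP.+-suc k' j')
    e3 : n ∸ suc (suc k') ≡ j'
    e3 = ≡.trans (≡.cong (_∸ suc (suc k')) en) (ℕP.m+n∸m≡n (suc (suc k')) j')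

  -- 0 < k ≤ n: Pascal's rule splits C(n+1,k) and interior-step does the rest
  recurrence-inside : ∀ k' j → ClosedFormRecurrence (suc k' ℕ.+ j) (suc k')
  recurrence-inside k' j = begin
    binom (suc n) (suc k') * d a (n ∸ k') ≈⟨ *-cong (binom-pascal n k') (d-cong e1) ⟩
    (binom n k' + binom n (suc k')) * d a (suc j) ≈⟨ distribʳ _ _ _ ⟩
    binom n k' * d a (suc j) + binom n (suc k') * d a (suc j) ≈⟨ +-cong (*-congˡ (d-cong (≡.sym e1))) (interior-step k' j) ⟩
    binom n k' * d a (n ∸ k') + (fromℕ (suc (suc k')) * (a * (binom n (suc (suc k')) * d a (n ∸ suc (suc k')))) + fromℕ j * (binom n (suc k') * d a j))
      ≈⟨ +-congˡ (+-congˡ (≡⇒≈ (≡.cong₂ (λ u v → fromℕ u * (binom n (suc k') * d a v)) (≡.sym e2) (≡.sym e2)))) ⟩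
    binom n k' * d a (n ∸ k') + (fromℕ (suc (suc k')) * (a * (binom n (suc (suc k')) * d a (n ∸ suc (suc k')))) + fromℕ (n ∸ suc k') * (binom n (suc k') * d a (n ∸ suc k'))) ∎
    where
    n : ℕ
    n = suc k' ℕ.+ j
    e1 : n ∸ k' ≡ suc j
    e1 = ≡.trans (≡.cong (_∸ k') (≡.sym (ℕP.+-suc k' j))) (ℕP.m+n∸m≡n k' (suc j))
    e2 : n ∸ suc k' ≡ j
    e2 = ℕP.m+n∸m≡n (suc k') j

  -- k > n: all terms vanish, except C(n,n) d_a(0) when k = n+1
  recurrence-beyond : ∀ n k' → n ≤ k' → ClosedFormRecurrence n (suc k')
  recurrence-beyond n k' le with n ℕP.≟ k'
  ... | yes ≡.refl = begin
    binom (suc n) (suc n) * d a (n ∸ n)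
      ≈⟨ *-cong (binom-diag (suc n)) d-at-0 ⟩
    1# * 1#
      ≈⟨ solve 4 (λ x y u v → con (ℤ.+ 1) :* con (ℤ.+ 1)
                    := con (ℤ.+ 1) :* con (ℤ.+ 1) :+ (x :* (y :* (con (ℤ.+ 0) :* u)) :+ con (ℤ.+ 0) :* v))
           refl (fromℕ (suc (suc n))) a far next ⟩
    1# * 1# + (fromℕ (suc (suc n)) * (a * (0# * far)) + 0# * next)
      ≈⟨ sym (+-cong (*-cong (binom-diag n) d-at-0) (+-cong (*-congˡ (*-congˡ (*-congʳ binom-far))) (*-congʳ no-room))) ⟩
    binom n n * d a (n ∸ n) + (fromℕ (suc (suc n)) * (a * (binom n (suc (suc n)) * far)) + fromℕ (n ∸ suc n) * next) ∎
    where
    far next : Carrier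
    far  = d a (n ∸ suc (suc n))
    next = binom n (suc n) * d a (n ∸ suc n)
    d-at-0 : d a (n ∸ n) ≈ 1#
    d-at-0 = trans (d-cong (ℕP.n∸n≡0 n)) (d-zero a)
    binom-far : binom n (suc (suc n)) ≈ 0#
    binom-far = binom-big n (suc (suc n)) (ℕP.m≤n⇒m≤1+n (ℕP.n<1+n n))
    no-room : fromℕ (n ∸ suc n) ≈ 0#
    no-room = ≡⇒≈ (≡.cong fromℕ (ℕP.m≤n⇒m∸n≡0 (ℕP.n≤1+n n)))
  ... | no n≢k' = trans lhs≈0 (sym rhs≈0)
    where
    n<k' : n < k'
    n<k' = ℕP.≤∧≢⇒< le n≢k'
    vanishes : ∀ N m x → binom N m ≈ 0# → binom N m * x ≈ 0#
    vanishes N m x h = trans (*-congʳ h) (zeroˡ x)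
    lhs≈0 : closedForm (suc n) (suc k') ≈ 0#
    lhs≈0 = vanishes (suc n) (suc k') _ (binom-big (suc n) (suc k') (s≤s n<k'))
    rhs≈0 : closedForm n k' + (fromℕ (suc (suc k')) * (a * closedForm n (suc (suc k'))) + fromℕ (n ∸ suc k') * closedForm n (suc k'))
            ≈ 0#
    rhs≈0 = begin
      closedForm n k' + (fromℕ (suc (suc k')) * (a * closedForm n (suc (suc k'))) + fromℕ (n ∸ suc k') * closedForm n (suc k'))
        ≈⟨ +-cong (vanishes n k' _ (binom-big n k' n<k'))
                  (+-cong (*-congˡ (*-congˡ (vanishes n (suc (suc k')) _
                                               (binom-big n (suc (suc k')) (ℕP.m≤n⇒m≤1+n (ℕP.m≤n⇒m≤1+n n<k'))))))
                          (*-congʳ (≡⇒≈ (≡.cong fromℕ (ℕP.m≤n⇒m∸n≡0 (ℕP.m≤n⇒m≤1+n le)))))) ⟩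
      0# + (fromℕ (suc (suc k')) * (a * 0#) + 0# * closedForm n (suc k'))
        ≈⟨ solve 3 (λ x y z → con (ℤ.+ 0) :+ (x :* (y :* con (ℤ.+ 0)) :+ con (ℤ.+ 0) :* z) := con (ℤ.+ 0))
             refl (fromℕ (suc (suc k'))) a (closedForm n (suc k')) ⟩
      0# ∎

  closedForm-recurrence : ∀ n k → ClosedFormRecurrence n k
  closedForm-recurrence n zero = recurrence-at-0 n
  closedForm-recurrence n (suc k') with suc k' ℕ.≤? n
  ... | yes le = ≡.subst (λ m → ClosedFormRecurrence m (suc k')) (ℕP.m+[n∸m]≡n le) (recurrence-inside k' (n ∸ suc k'))
  ... | no nle = recurrence-beyond n k' (ℕP.≤-pred (ℕP.≰⇒> nle))

  Fix≈closedForm : ∀ n k → Fix n k ≈ closedForm n k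
  Fix≈closedForm zero zero = sym (trans (*-cong (binom-zero 0) (d-zero a)) (*-identityˡ 1#))
  Fix≈closedForm zero (suc k) = sym (trans (*-congʳ (binom-big 0 (suc k) (s≤s z≤n))) (zeroˡ _))
  Fix≈closedForm (suc n) k = begin
    Fix (suc n) k
      ≈⟨ Fix-recurrence n k ⟩
    previous (Fix n) k + (fromℕ (suc k) * (a * Fix n (suc k)) + fromℕ (n ∸ k) * Fix n k)
      ≈⟨ +-cong (previous-step k) (+-cong (*-congˡ (*-congˡ (Fix≈closedForm n (suc k)))) (*-congˡ (Fix≈closedForm n k))) ⟩
    previous (closedForm n) k + (fromℕ (suc k) * (a * closedForm n (suc k)) + fromℕ (n ∸ k) * closedForm n k)
      ≈⟨ sym (closedForm-recurrence n k) ⟩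
    closedForm (suc n) k ∎
    where
    previous-step : ∀ k → previous (Fix n) k ≈ previous (closedForm n) k
    previous-step zero    = refl
    previous-step (suc k) = Fix≈closedForm n k

  D≈d : ∀ n → D a n ≈ d a n
  D≈d n = trans (D≈Fix0 n) (trans (Fix≈closedForm n 0) (trans (*-congʳ (binom-zero n)) (*-identityˡ _)))


-- Both sides satisfy X(l+1,m,n) = X(l,m+1,n+1) and agree on the plane l = 0,
-- hence everywhere (induction on l).
mainTheorem6 : ∀ {c ℓ} (R : CommutativeRing c ℓ) (α β : CommutativeRing.Carrier R) (l m n : ℕ)
    → CommutativeRing._≈_ R (Series.LHS R α β l m n) (Series.RHS R α β l m n)
mainTheorem6 R α β = agree
  where
  open import Data.Nat using (zero; suc)
  import Data.Nat.Properties as ℕP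
  open import Relation.Binary.PropositionalEquality as ≡ using (_≡_)
  open RingArithmetic R
  open DerangementSequence R using (d)
  open FixedPointClosedForm R α using () renaming (D≈d to Dα≈dα)
  open FixedPointClosedForm R β using () renaming (D≈d to Dβ≈dβ)
  open RightHandSide R α β using (shift-relation)
  open RightHandSideAtZero R α β using (rhs-at-x0)

  lhs-shift : ∀ l m n → LHS α β (suc l) m n ≡ LHS α β l (suc m) (suc n)
  lhs-shift l m n = ≡.cong₂ (λ u v → D α u * D β v) (≡.sym (ℕP.+-suc l m)) (≡.sym (ℕP.+-suc l n))

  agree : ∀ l m n → LHS α β l m n ≈ RHS α β l m n
  agree zero m n = begin
    D α m * D β n        ≈⟨ *-cong (Dα≈dα m) (Dβ≈dβ n) ⟩
    d α m * d β n        ≈⟨ sym (rhs-at-x0 m n) ⟩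
    RHS α β 0 m n        ∎
  agree (suc l) m n = begin
    LHS α β (suc l) m n         ≡⟨ lhs-shift l m n ⟩
    LHS α β l (suc m) (suc n)   ≈⟨ agree l (suc m) (suc n) ⟩
    RHS α β l (suc m) (suc n)   ≈⟨ sym (shift-relation l m n) ⟩
    RHS α β (suc l) m n         ∎
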